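{- Let $G=(L,R,E)$ be a finite bipartite graph, run Algorithm PivotBiCluster on $G$, and for each tuple $T$ let $q_T=\Pr[X_T]$ and $$\beta(T)=\alpha_T\cdot q_T\cdot\min\{|R_{1,2}^T|,|R_2^T|\},\qquad \alpha_T=\min\Big\{1,\frac{|R_{1,2}^T|}{\min\{|R_{1,2}^T|,|R_1^T|\}+\min\{|R_{1,2}^T|,|R_2^T|\}}\Big\}$$ (with $\beta(T)=0$ when $R_{1,2}^T=\emptyset$). Then for every edge $(\ell,r)\in E$, $$\sum_{T:\,\ell_2^T=\ell,\ r\in R_2^T}\frac{\beta(T)}{|R_2^T|}+\sum_{T:\,\ell_1^T=\ell,\ r\in R_{1,2}^T}\frac{\beta(T)}{|R_{1,2}^T|}+\sum_{T:\,\ell_2^T=\ell,\ r\in R_{1,2}^T}\frac{\beta(T)}{|R_{1,2}^T|}\le 1,$$ and for every pair $(\ell,r)\in (L\times R)\setminus E$, $$\sum_{T:\,\ell_1^T=\ell,\ r\in R_2^T}\frac{\beta(T)}{|R_2^T|}\le 1.$$ That is, $\beta$ is a feasible solution of the linear program: maximize $\sum_T\beta(T)$ subject to these constraints and $\beta\ge 0$ (the dual of the LP $\min\sum_{e\in L\times R}x(e)$ subject to, for every tuple $T$ with $R_2^T,R_{1,2}^T\neq\emptyset$, $\frac{1}{|R_2^T|}\sum_{r\in R_2^T}(x_{\ell_1^T,r}+x_{\ell_2^T,r})+\frac{1}{|R_{1,2}^T|}\sum_{r\in R_{1,2}^T}(x_{\ell_1^T,r}+x_{\ell_2^T,r})\ge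 1$, $x\ge0$).
   Context: Input: bipartite graph $G=(L,R,E)$, $E\subseteq L\times R$. Algorithm PivotBiCluster: $N(\ell)$ denotes the set of right nodes adjacent to $\ell\in L$ not yet removed. While left nodes remain: choose a remaining left node $\ell_1$ uniformly at random (the "left center") and form $C=\{\ell_1\}\cup N(\ell_1)$. For each other remaining left node $\ell_2$, with neighborhoods at the moment $\ell_1$ was chosen, let $R_1=N(\ell_1)\setminus N(\ell_2)$, $R_{1,2}=N(\ell_1)\cap N(\ell_2)$, $R_2=N(\ell_2)\setminus N(\ell_1)$; with probability $\min\{|R_{1,2}|/|R_2|,1\}$ (taken as $1$ if $|R_2|=0$): if $|R_{1,2}|\ge|R_1|$ append $\ell_2$ to $C$, else make $\ell_2$ a singleton; otherwise do nothing with $\ell_2$. Remove $C$ and the new singletons and repeat. A tuple is $T=(\ell_1^T,\ell_2^T,R_1^T,R_{1,2}^T,R_2^T)$ with $\ell_1^T\neq\ell_2^T\in L$, and (with $N$ the neighborhood in $G$) $R_1^T\subseteq N(\ell_1^T)\setminus N(\ell_2^T)$, $R_2^T\subseteq N(\ell_2^T)\setminus N(\ell_1^T)$, $R_{1,2}^T\subseteq N(\ell_1^T)\cap N(\ell_2^T)$. The bad event $X_T$ happens if during the execution $\ell_1^T$ is chosen as left center while $\ell_2^T$ is still in the graph and at that moment the current neighborhoods satisfy $R_1^T=N(\ell_1^T)\setminus N(\ell_2^T)$, $R_{1,2}^T=N(\ell_1^T)\cap N(\ell_2^T)$, $R_2^T=N(\ell_2^T)\setminus N(\ell_1^T)$.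 All sums above range over tuples $T$. -}

module Defs where

open import Data.Bool using (Bool; true; false; if_then_else_; _∧_; _∨_; not)
open import Data.Nat as ℕ using (ℕ; zero; suc)
open import Data.Integer using (+_)
open import Data.Rational using (ℚ; 0ℚ; 1ℚ; _+_; _*_; _-_; _/_; _⊓_)
open import Data.Fin using (Fin; zero; suc)
open import Data.Fin.Properties using (_≟_)
open import Data.Fin.Subset using (Subset; ⊥; ∣_∣; _∩_; _─_; _∪_; ⁅_⁆)
open import Data.Vec using (Vec; []; _∷_; lookup)
open import Data.List using (List; []; _∷_; concatMap; map; foldr; filter; allFin)
open import Data.Product using (_×_; _,_; proj₁; proj₂)
open import Relation.Nullary.Decidable using (⌊_⌋)

-- a / b as a rational, with the convention a / 0 = 0 (only used where b > 0)
ratio : ℕ → ℕ → ℚ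
ratio a zero    = 0ℚ
ratio a (suc b) = (+ a) / suc b

mem : ∀ {n} → Fin n → Subset n → Bool
mem i p = lookup p i

eqFin : ∀ {n} → Fin n → Fin n → Bool
eqFin i j = ⌊ i ≟ j ⌋

eqSub : ∀ {n} → Subset n → Subset n → Bool
eqSub []       []       = true
eqSub (x ∷ xs) (y ∷ ys) = (if x then y else not y) ∧ eqSub xs ys

allSubsets : (n : ℕ) → List (Subset n)
allSubsets zero    = [] ∷ []
allSubsets (suc n) = concatMap (λ s → (true ∷ s) ∷ (false ∷ s) ∷ []) (allSubsets n)

elems : ∀ {n} → Subset n → List (Fin n)
elems {n} p = filter (λ i → Data.Bool._≟_ (lookup p i) true) (allFin n)
  where import Data.Bool

sumℚ : List ℚ → ℚ
sumℚ = foldr _+_ 0ℚ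

Dist : Set → Set
Dist A = List (ℚ × A)

return : ∀ {A} → A → Dist A
return a = (1ℚ , a) ∷ []

_>>=_ : ∀ {A B} → Dist A → (A → Dist B) → Dist B
d >>= f = concatMap (λ { (p , a) → map (λ { (q , b) → (p * q , b) }) (f a) }) d

bernoulli : ℚ → Dist Bool
bernoulli p = (p , true) ∷ (1ℚ - p , false) ∷ []

uniform : ∀ {n} → Subset n → Dist (Fin n)
uniform p = map (λ i → (ratio 1 (∣ p ∣) , i)) (elems p)

Pr : ∀ {A} → Dist A → (A → Bool) → ℚ
Pr d P = sumℚ (map (λ { (p , a) → if P a then p else 0ℚ }) d)

-- Bipartite graphs: L = Fin m, R = Fin n, E given by the neighbourhood
-- of each left node ((ℓ , r) ∈ E  iff  r ∈ E ℓ).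

BiGraph : ℕ → ℕ → Set
BiGraph m n = Fin m → Subset n

Nb : ∀ {m n} → BiGraph m n → Subset n → Fin m → Subset n
Nb E remR ℓ = E ℓ ∩ remR

-- probability min{|R12|/|R2|, 1} (taken as 1 if |R2| = 0)
coinProb : ℕ → ℕ → ℚ
coinProb r12 r2 = if ⌊ r2 ℕ.≤? r12 ⌋ then 1ℚ else ratio r12 r2

-- One step of the trace: the chosen left center together with the sets
-- of remaining left and right nodes at the moment it was chosen.
record Step (m n : ℕ) : Set where
  constructor step
  field
    center : Fin m
    remL   : Subset m
    remR   : Subset n

-- Independent coin flips for the other remaining left nodes; returns the
-- set of left nodes that are removed (appended to C if |R12| ≥ |R1|,
-- made singletons otherwise -- in both cases they leave the graph).
coins : ∀ {m n} → BiGraph m n → Subset n → Fin m → List (Fin m) → Dist (Subset m)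
coins E remR ℓ₁ []        = return ⊥
coins E remR ℓ₁ (ℓ₂ ∷ ls) =
  coins E remR ℓ₁ ls >>= λ S →
  bernoulli (coinProb (∣ Nb E remR ℓ₁ ∩ Nb E remR ℓ₂ ∣) (∣ Nb E remR ℓ₂ ─ Nb E remR ℓ₁ ∣)) >>= λ b →
  return (if b then S ∪ ⁅ ℓ₂ ⁆ else S)

-- Run the algorithm with a fuel bound (each round removes its center,
-- so fuel m suffices); returns the distribution of traces.
run : ∀ {m n} → BiGraph m n → ℕ → Subset m → Subset n → Dist (List (Step m n))
run E zero    remL remR = return []
run E (suc f) remL remR with ∣ remL ∣
... | zero  = return []
... | suc _ =
  uniform remL >>= λ ℓ₁ →
  coins E remR ℓ₁ (elems (remL ─ ⁅ ℓ₁ ⁆)) >>= λ S →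
  run E f ((remL ─ ⁅ ℓ₁ ⁆) ─ S) (remR ─ Nb E remR ℓ₁) >>= λ rest →
  return (step ℓ₁ remL remR ∷ rest)

pivotBiCluster : ∀ {m n} → BiGraph m n → Dist (List (Step m n))
pivotBiCluster {m} {n} E = run E m (Data.Vec.replicate m true) (Data.Vec.replicate n true)
  where import Data.Vec

record Tuple (m n : ℕ) : Set where
  constructor tuple
  field
    ℓ₁ ℓ₂ : Fin m
    R₁ R₁₂ R₂ : Subset n
open Tuple public

subB : ∀ {n} → Subset n → Subset n → Bool
subB p q = eqSub (p ∩ q) p

validTuple : ∀ {m n} → BiGraph m n → Tuple m n → Bool
validTuple E T =
  not (eqFin (ℓ₁ T) (ℓ₂ T))
  ∧ subB (R₁ T) (E (ℓ₁ T) ─ E (ℓ₂ T))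
  ∧ subB (R₂ T) (E (ℓ₂ T) ─ E (ℓ₁ T))
  ∧ subB (R₁₂ T) (E (ℓ₁ T) ∩ E (ℓ₂ T))

tuples : ∀ {m n} → BiGraph m n → List (Tuple m n)
tuples {m} {n} E =
  filter (λ T → Data.Bool._≟_ (validTuple E T) true)
   (concatMap (λ a → concatMap (λ b → concatMap (λ r1 → concatMap (λ r12 → map (λ r2 →
      tuple a b r1 r12 r2) (allSubsets n)) (allSubsets n)) (allSubsets n)) (allFin m)) (allFin m))
  where import Data.Bool

XStep : ∀ {m n} → BiGraph m n → Tuple m n → Step m n → Bool
XStep E T (step c remL remR) =
  eqFin c (ℓ₁ T) ∧ mem (ℓ₂ T) remL
  ∧ eqSub (R₁ T)  (Nb E remR (ℓ₁ T) ─ Nb E remR (ℓ₂ T))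
  ∧ eqSub (R₁₂ T) (Nb E remR (ℓ₁ T) ∩ Nb E remR (ℓ₂ T))
  ∧ eqSub (R₂ T)  (Nb E remR (ℓ₂ T) ─ Nb E remR (ℓ₁ T))

XT : ∀ {m n} → BiGraph m n → Tuple m n → List (Step m n) → Bool
XT E T = foldr (λ s b → XStep E T s ∨ b) false

q : ∀ {m n} → BiGraph m n → Tuple m n → ℚ
q E T = Pr (pivotBiCluster E) (XT E T)

minℕ : ℕ → ℕ → ℕ
minℕ = ℕ._⊓_

α : ∀ {m n} → Tuple m n → ℚ
α T = 1ℚ ⊓ ratio (∣ R₁₂ T ∣) (minℕ (∣ R₁₂ T ∣) (∣ R₁ T ∣) ℕ.+ minℕ (∣ R₁₂ T ∣) (∣ R₂ T ∣))

β : ∀ {m n} → BiGraph m n → Tuple m n → ℚ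
β E T with ∣ R₁₂ T ∣
... | zero  = 0ℚ
... | suc _ = α T * q E T * ((+ minℕ (∣ R₁₂ T ∣) (∣ R₂ T ∣)) / 1)

sumOver : ∀ {m n} → BiGraph m n → (Tuple m n → Bool) → (Tuple m n → ℚ) → ℚ
sumOver E P f = sumℚ (map (λ T → if P T then f T else 0ℚ) (tuples E))

edgeLHS : ∀ {m n} → BiGraph m n → Fin m → Fin n → ℚ
edgeLHS E ℓ r =
    sumOver E (λ T → eqFin (ℓ₂ T) ℓ ∧ mem r (R₂ T))  (λ T → β E T * ratio 1 (∣ R₂ T ∣))
  + sumOver E (λ T → eqFin (ℓ₁ T) ℓ ∧ mem r (R₁₂ T)) (λ T → β E T * ratio 1 (∣ R₁₂ T ∣))
  + sumOver E (λ T → eqFin (ℓ₂ T) ℓ ∧ mem r (R₁₂ T)) (λ T → β E T * ratio 1 (∣ R₁₂ T ∣))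

nonEdgeLHS : ∀ {m n} → BiGraph m n → Fin m → Fin n → ℚ
nonEdgeLHS E ℓ r =
  sumOver E (λ T → eqFin (ℓ₁ T) ℓ ∧ mem r (R₂ T)) (λ T → β E T * ratio 1 (∣ R₂ T ∣))

module Submission where

-- Fix a pair (ℓ , r).  Each constraint has the form ∑_T K(T) · q_T ≤ 1, where
-- K(T) ≥ 0 is the share of β(T)/q_T charged to (ℓ , r).  Since q_T = Pr[X_T]
-- and X_T can only happen in a round with center ℓ₁^T, the left-hand side is
-- at most the expected total charge of the rounds of a run, where a round
-- with center c and remaining left nodes L charges the tuples (c , b , …),
-- b ∈ L, whose sets are determined by the round (∑q≤expected-charge).  The
-- expected total charge is bounded by a potential argument (run-potential):
-- the indicator that ℓ and r are both still present is a potential, because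
-- in every round the expected charge plus the probability that (ℓ , r)
-- survives is at most one (present-potential).  After exchanging the roles
-- of center and second node (charge-exchange) this is a statement about a
-- single center c.  For an edge it follows from two facts about the weights:
-- the R₂-share of a tuple is at most the probability that its second node is
-- removed (weight-share≤coin), and the R₁₂-shares of a tuple and of its
-- mirror image sum to at most one (weight-pair); for a non-edge it is easier.

open import Defs
open import Data.Bool using (Bool; true; false; if_then_else_; _∧_; _∨_; not)
import Data.Bool as Bool
import Data.Bool.Properties as BoolP
open import Data.Nat as ℕ using (ℕ; zero; suc)
import Data.Nat.Properties as ℕP
open import Data.Nat.Tactic.RingSolver using (solve-∀)
import Data.Integer as ℤ
import Data.Integer.Properties as ℤP
open import Data.Rational using (ℚ; 0ℚ; 1ℚ; _+_; _*_; _-_; -_; _≤_; _⊓_; _/_; toℚᵘ; nonNegative)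
open import Data.Rational.Properties hiding (_≟_)
open import Data.Rational.Solver using (module +-*-Solver)
open import Data.Rational.Unnormalised as ℚᵘ using (ℚᵘ; mkℚᵘ; *≡*; *≤*) renaming (_≃_ to _≃ᵘ_; _≤_ to _≤ᵘ_)
import Data.Rational.Unnormalised.Properties as ℚᵘP
open import Data.Fin using (Fin; zero; suc)
open import Data.Fin.Properties using (_≟_)
open import Data.Fin.Subset using (Subset; ∣_∣; _∩_; _─_; _∪_; ⁅_⁆; _∈_; _∉_) renaming (⊥ to ∅)
import Data.Fin.Subset.Properties as SubsetP
open import Data.Vec using ([]; _∷_; lookup; replicate)
import Data.Vec.Properties as VecP
open import Data.List using (List; []; _∷_; _++_; map; concatMap; filter; allFin; tabulate; foldr)
open import Data.List.Relation.Unary.All as All using (All; []; _∷_)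
import Data.List.Relation.Unary.All.Properties as AllP
open import Data.List.Relation.Unary.Any using (here; there)
import Data.List.Membership.Propositional as ListMem
import Data.List.Membership.Propositional.Properties as ListMemP
open import Data.Product using (_×_; _,_; proj₁; proj₂)
open import Function using (_∘_)
open import Relation.Binary.PropositionalEquality
open import Relation.Nullary using (yes; no; contradiction)

open +-*-Solver using (solve; _:=_; _:+_; _:-_; _:*_; con)

private variable
  A B : Set
  n   : ℕ

0≤1 : 0ℚ ≤ 1ℚ
0≤1 = nonNegative⁻¹ 1ℚ

*-nonneg : ∀ {p q} → 0ℚ ≤ p → 0ℚ ≤ q → 0ℚ ≤ p * q
*-nonneg {p} {q} 0≤p 0≤q =
  nonNegative⁻¹ (p * q) {{nonNeg*nonNeg⇒nonNeg p {{nonNegative 0≤p}} q {{nonNegative 0≤q}}}}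

*-monoˡ-nonneg : ∀ {c p q} → 0ℚ ≤ c → p ≤ q → c * p ≤ c * q
*-monoˡ-nonneg {c} 0≤c = *-monoˡ-≤-nonNeg c {{nonNegative 0≤c}}

*-monoʳ-nonneg : ∀ {c p q} → 0ℚ ≤ c → p ≤ q → p * c ≤ q * c
*-monoʳ-nonneg {c} 0≤c = *-monoʳ-≤-nonNeg c {{nonNegative 0≤c}}

p+[1-p] : ∀ p → p + (1ℚ - p) ≡ 1ℚ
p+[1-p] = solve 1 (λ p → p :+ (con 1ℚ :- p) := con 1ℚ) refl

0≤1-p : ∀ {p} → p ≤ 1ℚ → 0ℚ ≤ 1ℚ - p
0≤1-p {p} p≤1 = ≤-trans (≤-reflexive (sym (+-inverseʳ p))) (+-monoˡ-≤ (- p) p≤1)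

-- The embedding ℕ → ℚ in the form used by the definition of β.
nat : ℕ → ℚ
nat a = ℤ.+ a / 1

-- Identities and inequalities between the rationals `ratio a b` reduce, on
-- unnormalised representatives, to statements about natural numbers.
module RatioTransfer where
  open ℤ using (+_)

  toᵘ-ratio : ∀ a b → toℚᵘ (ratio a (suc b)) ≃ᵘ mkℚᵘ (+ a) b
  toᵘ-ratio a b = toℚᵘ-fromℚᵘ (mkℚᵘ (+ a) b)

  ≃ᵘ-fromℕ : ∀ {a b c d} → a ℕ.* suc d ≡ c ℕ.* suc b → mkℚᵘ (+ a) b ≃ᵘ mkℚᵘ (+ c) d
  ≃ᵘ-fromℕ {a} {b} {c} {d} e = *≡* (begin
    + a ℤ.* + suc d   ≡⟨ ℤP.pos-* a (suc d) ⟨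
    + (a ℕ.* suc d)   ≡⟨ cong +_ e ⟩
    + (c ℕ.* suc b)   ≡⟨ ℤP.pos-* c (suc b) ⟩
    + c ℤ.* + suc b   ∎)
    where open ≡-Reasoning

  ≤ᵘ-fromℕ : ∀ {a b c d} → a ℕ.* suc d ℕ.≤ c ℕ.* suc b → mkℚᵘ (+ a) b ≤ᵘ mkℚᵘ (+ c) d
  ≤ᵘ-fromℕ {a} {b} {c} {d} le =
    *≤* (subst₂ ℤ._≤_ (ℤP.pos-* a (suc d)) (ℤP.pos-* c (suc b)) (ℤ.+≤+ le))

  *ᵘ-fromℕ : ∀ a b c d → mkℚᵘ (+ a) b ℚᵘ.* mkℚᵘ (+ c) d ≃ᵘ mkℚᵘ (+ (a ℕ.* c)) (d ℕ.+ b ℕ.* suc d)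
  *ᵘ-fromℕ a b c d = *≡* (cong (ℤ._* (+ suc (d ℕ.+ b ℕ.* suc d))) (sym (ℤP.pos-* a c)))

  +ᵘ-fromℕ : ∀ a c → mkℚᵘ (+ a) 0 ℚᵘ.+ mkℚᵘ (+ c) 0 ≃ᵘ mkℚᵘ (+ (a ℕ.+ c)) 0
  +ᵘ-fromℕ a c = *≡* (cong (ℤ._* + 1) (begin
    + a ℤ.* + 1 ℤ.+ + c ℤ.* + 1   ≡⟨ cong₂ ℤ._+_ (ℤP.*-identityʳ (+ a)) (ℤP.*-identityʳ (+ c)) ⟩
    + a ℤ.+ + c                   ≡⟨ ℤP.pos-+ a c ⟨
    + (a ℕ.+ c)                   ∎))
    where open ≡-Reasoning

  transfer-≡ : ∀ {x y : ℚ} {u v : ℚᵘ} → toℚᵘ x ≃ᵘ u → toℚᵘ y ≃ᵘ v → u ≃ᵘ v → x ≡ y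
  transfer-≡ x≃u y≃v u≃v = toℚᵘ-injective (ℚᵘP.≃-trans x≃u (ℚᵘP.≃-trans u≃v (ℚᵘP.≃-sym y≃v)))

  transfer-≤ : ∀ {x y : ℚ} {u v : ℚᵘ} → toℚᵘ x ≃ᵘ u → toℚᵘ y ≃ᵘ v → u ≤ᵘ v → x ≤ y
  transfer-≤ x≃u y≃v u≤v =
    toℚᵘ-cancel-≤ (ℚᵘP.≤-respʳ-≃ (ℚᵘP.≃-sym y≃v) (ℚᵘP.≤-respˡ-≃ (ℚᵘP.≃-sym x≃u) u≤v))

  toᵘ-* : ∀ x y {u v} → toℚᵘ x ≃ᵘ u → toℚᵘ y ≃ᵘ v → toℚᵘ (x * y) ≃ᵘ (u ℚᵘ.* v)
  toᵘ-* x y x≃u y≃v = ℚᵘP.≃-trans (toℚᵘ-homo-* x y) (ℚᵘP.*-cong x≃u y≃v)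

  toᵘ-+ : ∀ x y {u v} → toℚᵘ x ≃ᵘ u → toℚᵘ y ≃ᵘ v → toℚᵘ (x + y) ≃ᵘ (u ℚᵘ.+ v)
  toᵘ-+ x y x≃u y≃v = ℚᵘP.≃-trans (toℚᵘ-homo-+ x y) (ℚᵘP.+-cong x≃u y≃v)

open RatioTransfer

ratio-nonneg : ∀ a b → 0ℚ ≤ ratio a b
ratio-nonneg a zero    = ≤-refl
ratio-nonneg a (suc b) = transfer-≤ ℚᵘP.≃-refl (toᵘ-ratio a b) (≤ᵘ-fromℕ ℕ.z≤n)

ratio≤1 : ∀ a b → a ℕ.≤ b → ratio a b ≤ 1ℚ
ratio≤1 a zero    _   = 0≤1
ratio≤1 a (suc b) a≤b = transfer-≤ (toᵘ-ratio a b) ℚᵘP.≃-refl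
  (≤ᵘ-fromℕ (subst₂ ℕ._≤_ (sym (ℕP.*-identityʳ a)) (sym (ℕP.*-identityˡ (suc b))) a≤b))

ratio-self : ∀ s → ratio (suc s) (suc s) ≡ 1ℚ
ratio-self s = transfer-≡ (toᵘ-ratio (suc s) s) ℚᵘP.≃-refl (≃ᵘ-fromℕ (ℕP.*-comm (suc s) 1))

nat-+ : ∀ a b → nat (a ℕ.+ b) ≡ nat a + nat b
nat-+ a b = transfer-≡ (toᵘ-ratio (a ℕ.+ b) 0) (toᵘ-+ (nat a) (nat b) (toᵘ-ratio a 0) (toᵘ-ratio b 0))
  (ℚᵘP.≃-sym (+ᵘ-fromℕ a b))

nat*ratio1 : ∀ a b → nat a * ratio 1 b ≡ ratio a b
nat*ratio1 a zero    = *-zeroʳ (nat a)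
nat*ratio1 a (suc b) = transfer-≡ (toᵘ-* (nat a) (ratio 1 (suc b)) (toᵘ-ratio a 0) (toᵘ-ratio 1 b)) (toᵘ-ratio a b)
  (ℚᵘP.≃-trans (*ᵘ-fromℕ a 0 1 b) (≃ᵘ-fromℕ (identity a b)))
  where
  identity : ∀ a b → a ℕ.* 1 ℕ.* suc b ≡ a ℕ.* suc (b ℕ.+ 0 ℕ.* suc b)
  identity = solve-∀

ratio*nat : ∀ a d → ratio a (suc d) * nat (suc d) ≡ nat a
ratio*nat a d = transfer-≡ (toᵘ-* (ratio a (suc d)) (nat (suc d)) (toᵘ-ratio a d) (toᵘ-ratio (suc d) 0)) (toᵘ-ratio a 0)
  (ℚᵘP.≃-trans (*ᵘ-fromℕ a d (suc d) 0) (≃ᵘ-fromℕ (identity a d)))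
  where
  identity : ∀ a d → a ℕ.* suc d ℕ.* 1 ≡ a ℕ.* suc (0 ℕ.+ d ℕ.* 1)
  identity = solve-∀

nat*inverse : ∀ k → nat (suc k) * ratio 1 (suc k) ≡ 1ℚ
nat*inverse k = trans (nat*ratio1 (suc k) (suc k)) (ratio-self k)

-- Guarded values: `when b x` is x if b holds and 0 otherwise.  This is the
-- shape of the summands of `sumOver` and of `Pr` in the definitions.
when : Bool → ℚ → ℚ
when b x = if b then x else 0ℚ

ind : Bool → ℚ
ind b = when b 1ℚ

when-nonneg : ∀ b {x} → 0ℚ ≤ x → 0ℚ ≤ when b x
when-nonneg true  0≤x = 0≤x
when-nonneg false _   = ≤-refl

when-mono : ∀ b {x y} → x ≤ y → when b x ≤ when b y
when-mono true  x≤y = x≤y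
when-mono false _   = ≤-refl

when≤ : ∀ b {x} → 0ℚ ≤ x → when b x ≤ x
when≤ true  _   = ≤-refl
when≤ false 0≤x = 0≤x

when-zero : ∀ b → when b 0ℚ ≡ 0ℚ
when-zero true  = refl
when-zero false = refl

when-+ : ∀ b x y → when b (x + y) ≡ when b x + when b y
when-+ true  x y = refl
when-+ false x y = sym (+-identityˡ 0ℚ)

when-∧ : ∀ a b x → when (a ∧ b) x ≡ when a (when b x)
when-∧ true  b x = refl
when-∧ false b x = refl

when-comm : ∀ a b x → when a (when b x) ≡ when b (when a x)
when-comm true  b x = refl
when-comm false b x = sym (when-zero b)

when-* : ∀ b x y → when b x * y ≡ when b (x * y)
when-* true  x y = refl
when-* false x y = *-zeroˡ y

guard : List Bool → ℚ → ℚ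
guard bs x = foldr when x bs

when-⋀ : ∀ bs b x → when (foldr _∧_ b bs) x ≡ guard bs (when b x)
when-⋀ []       b x = refl
when-⋀ (c ∷ bs) b x = trans (when-∧ c (foldr _∧_ b bs) x) (cong (when c) (when-⋀ bs b x))

when-∨ : ∀ a b {k} → 0ℚ ≤ k → when (a ∨ b) k ≤ when a k + when b k
when-∨ true  b {k} 0≤k = ≤-trans (≤-reflexive (sym (+-identityʳ k))) (+-monoʳ-≤ k (when-nonneg b 0≤k))
when-∨ false b 0≤k = ≤-reflexive (sym (+-identityˡ _))

∑ : List A → (A → ℚ) → ℚ
∑ xs f = sumℚ (map f xs)

∑-cong : ∀ (xs : List A) {f g} → (∀ x → f x ≡ g x) → ∑ xs f ≡ ∑ xs g
∑-cong []       f≡g = refl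
∑-cong (x ∷ xs) f≡g = cong₂ _+_ (f≡g x) (∑-cong xs f≡g)

∑-++ : ∀ (xs ys : List A) f → ∑ (xs ++ ys) f ≡ ∑ xs f + ∑ ys f
∑-++ []       ys f = sym (+-identityˡ _)
∑-++ (x ∷ xs) ys f = trans (cong (f x +_) (∑-++ xs ys f)) (sym (+-assoc (f x) _ _))

∑-zero : ∀ (xs : List A) → ∑ xs (λ _ → 0ℚ) ≡ 0ℚ
∑-zero []       = refl
∑-zero (x ∷ xs) = trans (+-identityˡ _) (∑-zero xs)

∑-+ : ∀ (xs : List A) f g → ∑ xs (λ x → f x + g x) ≡ ∑ xs f + ∑ xs g
∑-+ []       f g = sym (+-identityˡ 0ℚ)
∑-+ (x ∷ xs) f g = trans (cong (f x + g x +_) (∑-+ xs f g)) (+-interchange (f x) (g x) _ _)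
  where
  +-interchange : ∀ a b c d → (a + b) + (c + d) ≡ (a + c) + (b + d)
  +-interchange = solve 4 (λ a b c d → (a :+ b) :+ (c :+ d) := (a :+ c) :+ (b :+ d)) refl

∑-*ˡ : ∀ (xs : List A) c f → ∑ xs (λ x → c * f x) ≡ c * ∑ xs f
∑-*ˡ []       c f = sym (*-zeroʳ c)
∑-*ˡ (x ∷ xs) c f = trans (cong (c * f x +_) (∑-*ˡ xs c f)) (sym (*-distribˡ-+ c (f x) _))

∑-when : ∀ (xs : List A) b f → ∑ xs (λ x → when b (f x)) ≡ when b (∑ xs f)
∑-when xs true  f = refl
∑-when xs false f = ∑-zero xs

∑-guard : ∀ (xs : List A) bs f → ∑ xs (λ x → guard bs (f x)) ≡ guard bs (∑ xs f)
∑-guard xs []       f = refl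
∑-guard xs (b ∷ bs) f = trans (∑-when xs b _) (cong (when b) (∑-guard xs bs f))

∑-mono : ∀ (xs : List A) {f g} → (∀ x → f x ≤ g x) → ∑ xs f ≤ ∑ xs g
∑-mono []       f≤g = ≤-refl
∑-mono (x ∷ xs) f≤g = +-mono-≤ (f≤g x) (∑-mono xs f≤g)

∑-monoᴬ : ∀ (xs : List A) {f g} → All (λ x → f x ≤ g x) xs → ∑ xs f ≤ ∑ xs g
∑-monoᴬ []       []           = ≤-refl
∑-monoᴬ (x ∷ xs) (fx≤gx ∷ h) = +-mono-≤ fx≤gx (∑-monoᴬ xs h)

∑-filter : ∀ (b : A → Bool) xs f →
  ∑ (filter (λ x → b x Bool.≟ true) xs) f ≡ ∑ xs (λ x → when (b x) (f x))
∑-filter b []       f = refl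
∑-filter b (x ∷ xs) f with b x
... | true  = cong (f x +_) (∑-filter b xs f)
... | false = trans (∑-filter b xs f) (sym (+-identityˡ _))

∑-swap : (xs : List A) (ys : List B) (f : A → B → ℚ) →
  ∑ xs (λ x → ∑ ys (f x)) ≡ ∑ ys (λ y → ∑ xs (λ x → f x y))
∑-swap []       ys f = sym (∑-zero ys)
∑-swap (x ∷ xs) ys f = trans (cong (∑ ys (f x) +_) (∑-swap xs ys f)) (sym (∑-+ ys (f x) _))

∑-map : ∀ (g : A → B) xs f → ∑ (map g xs) f ≡ ∑ xs (f ∘ g)
∑-map g []       f = refl
∑-map g (x ∷ xs) f = cong (f (g x) +_) (∑-map g xs f)

∑-concatMap : ∀ (g : A → List B) xs f → ∑ (concatMap g xs) f ≡ ∑ xs (λ x → ∑ (g x) f)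
∑-concatMap g []       f = refl
∑-concatMap g (x ∷ xs) f = trans (∑-++ (g x) (concatMap g xs) f) (cong (∑ (g x) f +_) (∑-concatMap g xs f))

∑-tabulate : ∀ {n} (g : Fin n → A) f → ∑ (tabulate g) f ≡ ∑ (allFin n) (f ∘ g)
∑-tabulate {n = zero}  g f = refl
∑-tabulate {n = suc n} g f = cong (f (g zero) +_) (trans (∑-tabulate (g ∘ suc) f) (sym (∑-tabulate suc (f ∘ g))))

∑-allFin-suc : ∀ {n} f → ∑ (allFin (suc n)) f ≡ f zero + ∑ (allFin n) (f ∘ suc)
∑-allFin-suc f = cong (f zero +_) (∑-tabulate suc f)

Ex : Dist A → (A → ℚ) → ℚ
Ex d F = ∑ d (λ pa → proj₁ pa * F (proj₂ pa))

record IsProb (d : Dist A) : Set where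
  field
    weights-nonneg : All (λ pa → 0ℚ ≤ proj₁ pa) d
    mass-one       : Ex d (λ _ → 1ℚ) ≡ 1ℚ
open IsProb

Ex-cong : ∀ (d : Dist A) {F G} → (∀ a → F a ≡ G a) → Ex d F ≡ Ex d G
Ex-cong d F≡G = ∑-cong d (λ pa → cong (proj₁ pa *_) (F≡G (proj₂ pa)))

Ex-return : ∀ (a : A) F → Ex (return a) F ≡ F a
Ex-return a F = trans (+-identityʳ _) (*-identityˡ (F a))

Ex-bind : ∀ (d : Dist A) (k : A → Dist B) F → Ex (d >>= k) F ≡ Ex d (λ a → Ex (k a) F)
Ex-bind d k F = trans (∑-concatMap _ d _) (∑-cong d λ pa → begin
  ∑ (map _ (k (proj₂ pa))) _                                 ≡⟨ ∑-map _ (k (proj₂ pa)) _ ⟩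
  ∑ (k (proj₂ pa)) (λ qb → proj₁ pa * proj₁ qb * F (proj₂ qb)) ≡⟨ ∑-cong (k (proj₂ pa)) (λ qb → *-assoc (proj₁ pa) (proj₁ qb) _) ⟩
  ∑ (k (proj₂ pa)) (λ qb → proj₁ pa * (proj₁ qb * F (proj₂ qb))) ≡⟨ ∑-*ˡ (k (proj₂ pa)) (proj₁ pa) _ ⟩
  proj₁ pa * Ex (k (proj₂ pa)) F                              ∎)
  where open ≡-Reasoning

Ex-+ : ∀ (d : Dist A) F G → Ex d (λ a → F a + G a) ≡ Ex d F + Ex d G
Ex-+ d F G = trans (∑-cong d (λ pa → *-distribˡ-+ (proj₁ pa) _ _)) (∑-+ d _ _)

Ex-*ˡ : ∀ (d : Dist A) c F → Ex d (λ a → c * F a) ≡ c * Ex d F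
Ex-*ˡ d c F = trans (∑-cong d (λ pa → *-swapˡ (proj₁ pa) c _)) (∑-*ˡ d c _)
  where
  *-swapˡ : ∀ p c x → p * (c * x) ≡ c * (p * x)
  *-swapˡ = solve 3 (λ p c x → p :* (c :* x) := c :* (p :* x)) refl

Ex-zero : ∀ (d : Dist A) {F} → (∀ a → F a ≡ 0ℚ) → Ex d F ≡ 0ℚ
Ex-zero d F≡0 = trans (∑-cong d (λ pa → trans (cong (proj₁ pa *_) (F≡0 (proj₂ pa))) (*-zeroʳ (proj₁ pa)))) (∑-zero d)

∑-Ex : ∀ (d : Dist A) (xs : List B) (F : B → A → ℚ) → ∑ xs (λ x → Ex d (F x)) ≡ Ex d (λ a → ∑ xs (λ x → F x a))
∑-Ex d xs F = trans (∑-swap xs d _) (∑-cong d (λ pa → ∑-*ˡ xs (proj₁ pa) _))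

*-Pr : ∀ (d : Dist A) P k → k * Pr d P ≡ Ex d (λ a → when (P a) k)
*-Pr d P k = trans (sym (∑-*ˡ d k _)) (∑-cong d (λ pa → swap (P (proj₂ pa)) (proj₁ pa)))
  where
  swap : ∀ b p → k * when b p ≡ p * when b k
  swap true  p = *-comm k p
  swap false p = trans (*-zeroʳ k) (sym (*-zeroʳ p))

module _ {d : Dist A} (prob : IsProb d) where

  Ex-mono : ∀ {F G} → (∀ a → F a ≤ G a) → Ex d F ≤ Ex d G
  Ex-mono F≤G = ∑-monoᴬ d (All.map (λ {pa} 0≤p → *-monoˡ-nonneg 0≤p (F≤G (proj₂ pa))) (weights-nonneg prob))

  Ex-nonneg : ∀ {F} → (∀ a → 0ℚ ≤ F a) → 0ℚ ≤ Ex d F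
  Ex-nonneg 0≤F = ≤-trans (≤-reflexive (sym (Ex-zero d (λ _ → refl)))) (Ex-mono 0≤F)

  Ex-const : ∀ c → Ex d (λ _ → c) ≡ c
  Ex-const c = begin
    Ex d (λ _ → c)        ≡⟨ Ex-cong d (λ _ → sym (*-identityʳ c)) ⟩
    Ex d (λ _ → c * 1ℚ)   ≡⟨ Ex-*ˡ d c _ ⟩
    c * Ex d (λ _ → 1ℚ)   ≡⟨ cong (c *_) (mass-one prob) ⟩
    c * 1ℚ                ≡⟨ *-identityʳ c ⟩
    c                     ∎
    where open ≡-Reasoning

  Ex-const-+ : ∀ c F → Ex d (λ a → c + F a) ≡ c + Ex d F
  Ex-const-+ c F = trans (Ex-+ d (λ _ → c) F) (cong (_+ Ex d F) (Ex-const c))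

  Ex-≤-const : ∀ {F} c → (∀ a → F a ≤ c) → Ex d F ≤ c
  Ex-≤-const c F≤c = ≤-trans (Ex-mono F≤c) (≤-reflexive (Ex-const c))

isProb-return : ∀ (a : A) → IsProb (return a)
isProb-return a = record { weights-nonneg = 0≤1 ∷ [] ; mass-one = Ex-return a _ }

isProb-bind : ∀ {d : Dist A} {k : A → Dist B} → IsProb d → (∀ a → IsProb (k a)) → IsProb (d >>= k)
isProb-bind {d = d} {k} prob-d prob-k = record
  { weights-nonneg = nonneg d (weights-nonneg prob-d)
  ; mass-one       = trans (Ex-bind d k _) (trans (Ex-cong d (λ a → mass-one (prob-k a))) (mass-one prob-d))
  }
  where
  nonneg : ∀ d → All (λ pa → 0ℚ ≤ proj₁ pa) d → All (λ pa → 0ℚ ≤ proj₁ pa) (d >>= k)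
  nonneg []       []         = []
  nonneg (pa ∷ d) (0≤p ∷ h) =
    AllP.++⁺ (AllP.map⁺ (All.map (*-nonneg 0≤p) (weights-nonneg (prob-k (proj₂ pa))))) (nonneg d h)

Ex-bernoulli : ∀ p F → Ex (bernoulli p) F ≡ p * F true + (1ℚ - p) * F false
Ex-bernoulli p F = cong (p * F true +_) (+-identityʳ _)

isProb-bernoulli : ∀ {p} → 0ℚ ≤ p → p ≤ 1ℚ → IsProb (bernoulli p)
isProb-bernoulli {p} 0≤p p≤1 = record
  { weights-nonneg = 0≤p ∷ 0≤1-p p≤1 ∷ []
  ; mass-one       = trans (Ex-bernoulli p (λ _ → 1ℚ)) (trans (cong₂ _+_ (*-identityʳ p) (*-identityʳ _)) (p+[1-p] p))
  }

Pr-nonneg : ∀ {d : Dist A} → IsProb d → ∀ P → 0ℚ ≤ Pr d P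
Pr-nonneg {d = d} prob P = ≤-trans (Ex-nonneg prob (λ a → when-nonneg (P a) 0≤1))
  (≤-reflexive (trans (sym (*-Pr d P 1ℚ)) (*-identityˡ (Pr d P))))

mem-∩ : ∀ (i : Fin n) p q → mem i (p ∩ q) ≡ mem i p ∧ mem i q
mem-∩ i p q = VecP.lookup-zipWith _∧_ i p q

mem-∪ : ∀ (i : Fin n) p q → mem i (p ∪ q) ≡ mem i p ∨ mem i q
mem-∪ i p q = VecP.lookup-zipWith _∨_ i p q

mem-─ : ∀ (i : Fin n) p q → mem i (p ─ q) ≡ mem i p ∧ not (mem i q)
mem-─ zero    (x ∷ p) (true  ∷ q) = sym (BoolP.∧-zeroʳ x)
mem-─ zero    (x ∷ p) (false ∷ q) = sym (BoolP.∧-identityʳ x)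
mem-─ (suc i) (x ∷ p) (y ∷ q)     = mem-─ i p q

eqFin-refl : ∀ (i : Fin n) → eqFin i i ≡ true
eqFin-refl i with i ≟ i
... | yes _   = refl
... | no  i≢i = contradiction refl i≢i

eqFin-sym : ∀ (i j : Fin n) → eqFin i j ≡ eqFin j i
eqFin-sym i j with i ≟ j | j ≟ i
... | yes _   | yes _   = refl
... | no  _   | no  _   = refl
... | yes i≡j | no  j≢i = contradiction (sym i≡j) j≢i
... | no  i≢j | yes j≡i = contradiction (sym j≡i) i≢j

eqFin-suc : ∀ (i j : Fin n) → eqFin (Fin.suc i) (suc j) ≡ eqFin i j
eqFin-suc i j with i ≟ j
... | yes _ = refl
... | no  _ = refl

mem-⁅⁆ : ∀ (i j : Fin n) → mem i ⁅ j ⁆ ≡ eqFin i j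
mem-⁅⁆ zero    zero    = refl
mem-⁅⁆ zero    (suc j) = refl
mem-⁅⁆ (suc i) zero    = VecP.lookup-replicate i false
mem-⁅⁆ (suc i) (suc j) = trans (mem-⁅⁆ i j) (sym (eqFin-suc i j))

∑-elems : ∀ (L : Subset n) f → ∑ (elems L) f ≡ ∑ (allFin n) (λ i → when (mem i L) (f i))
∑-elems {n} L f = ∑-filter (lookup L) (allFin n) f

∑-count : ∀ (L : Subset n) x → ∑ (allFin n) (λ i → when (mem i L) x) ≡ nat ∣ L ∣ * x
∑-count []          x = sym (*-zeroˡ x)
∑-count (true ∷ L)  x = begin
  ∑ (allFin _) (λ i → when (mem i (true ∷ L)) x) ≡⟨ ∑-allFin-suc (λ i → when (mem i (true ∷ L)) x) ⟩
  x + ∑ (allFin _) (λ i → when (mem i L) x)   ≡⟨ cong₂ _+_ (sym (*-identityˡ x)) (∑-count L x) ⟩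
  1ℚ * x + nat ∣ L ∣ * x                      ≡⟨ *-distribʳ-+ x 1ℚ (nat ∣ L ∣) ⟨
  (1ℚ + nat ∣ L ∣) * x                        ≡⟨ cong (_* x) (nat-+ 1 ∣ L ∣) ⟨
  nat (suc ∣ L ∣) * x                         ∎
  where open ≡-Reasoning
∑-count (false ∷ L) x = trans (∑-allFin-suc (λ i → when (mem i (false ∷ L)) x)) (trans (+-identityˡ _) (∑-count L x))

∑-collapseFin : ∀ (c : Fin n) g → ∑ (allFin n) (λ a → when (eqFin a c) (g a)) ≡ g c
∑-collapseFin {suc n} zero    g = begin
  ∑ (allFin (suc n)) (λ a → when (eqFin a zero) (g a))   ≡⟨ ∑-allFin-suc (λ a → when (eqFin a zero) (g a)) ⟩
  g zero + ∑ (allFin n) (λ _ → 0ℚ)                      ≡⟨ cong (g zero +_) (∑-zero (allFin n)) ⟩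
  g zero + 0ℚ                                           ≡⟨ +-identityʳ _ ⟩
  g zero                                                ∎
  where open ≡-Reasoning
∑-collapseFin {suc n} (suc c) g = begin
  ∑ (allFin (suc n)) (λ a → when (eqFin a (suc c)) (g a))          ≡⟨ ∑-allFin-suc (λ a → when (eqFin a (suc c)) (g a)) ⟩
  0ℚ + ∑ (allFin n) (λ a → when (eqFin (Fin.suc a) (suc c)) (g (suc a))) ≡⟨ +-identityˡ _ ⟩
  ∑ (allFin n) (λ a → when (eqFin (Fin.suc a) (suc c)) (g (suc a)))      ≡⟨ ∑-cong (allFin n) (λ a → cong (λ b → when b (g (suc a))) (eqFin-suc a c)) ⟩
  ∑ (allFin n) (λ a → when (eqFin a c) (g (suc a)))                 ≡⟨ ∑-collapseFin c (λ a → g (suc a)) ⟩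
  g (suc c)                                                        ∎
  where open ≡-Reasoning

∑-collapseFin′ : ∀ (c : Fin n) g → ∑ (allFin n) (λ a → when (eqFin c a) (g a)) ≡ g c
∑-collapseFin′ {n} c g = trans (∑-cong (allFin n) (λ a → cong (λ b → when b (g a)) (eqFin-sym c a))) (∑-collapseFin c g)

∑-collapseSub : ∀ (X : Subset n) g → ∑ (allSubsets n) (λ s → when (eqSub s X) (g s)) ≡ g X
∑-collapseSub {zero}  []          g = +-identityʳ _
∑-collapseSub {suc n} (true ∷ X)  g = trans (∑-concatMap _ (allSubsets n) _)
  (trans (∑-cong (allSubsets n) (λ s → trans (cong (when (eqSub s X) (g (true ∷ s)) +_) (+-identityʳ 0ℚ)) (+-identityʳ _)))
    (∑-collapseSub X (λ s → g (true ∷ s))))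
∑-collapseSub {suc n} (false ∷ X) g = trans (∑-concatMap _ (allSubsets n) _)
  (trans (∑-cong (allSubsets n) (λ s → trans (+-identityˡ _) (+-identityʳ _)))
    (∑-collapseSub X (λ s → g (false ∷ s))))

coinProb-nonneg : ∀ a b → 0ℚ ≤ coinProb a b
coinProb-nonneg a b with b ℕ.≤? a
... | yes _ = 0≤1
... | no  _ = ratio-nonneg a b

coinProb≤1 : ∀ a b → coinProb a b ≤ 1ℚ
coinProb≤1 a b with b ℕ.≤? a
... | yes _   = ≤-refl
... | no  b≰a = ratio≤1 a b (ℕP.<⇒≤ (ℕP.≰⇒> b≰a))

Ex-uniform : ∀ (L : Subset n) F → Ex (uniform L) F ≡ ratio 1 ∣ L ∣ * ∑ (allFin n) (λ c → when (mem c L) (F c))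
Ex-uniform L F = trans (∑-map _ (elems L) _) (trans (∑-*ˡ (elems L) (ratio 1 ∣ L ∣) F) (cong (ratio 1 ∣ L ∣ *_) (∑-elems L F)))

average-one : ∀ (L : Subset n) {k} → ∣ L ∣ ≡ suc k → ratio 1 ∣ L ∣ * ∑ (allFin n) (λ c → when (mem c L) 1ℚ) ≡ 1ℚ
average-one L {k} ∣L∣≡1+k = begin
  ratio 1 ∣ L ∣ * ∑ (allFin _) (λ c → when (mem c L) 1ℚ) ≡⟨ cong (ratio 1 ∣ L ∣ *_) (trans (∑-count L 1ℚ) (*-identityʳ _)) ⟩
  ratio 1 ∣ L ∣ * nat ∣ L ∣                               ≡⟨ *-comm (ratio 1 ∣ L ∣) (nat ∣ L ∣) ⟩
  nat ∣ L ∣ * ratio 1 ∣ L ∣                               ≡⟨ cong (λ s → nat s * ratio 1 s) ∣L∣≡1+k ⟩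
  nat (suc k) * ratio 1 (suc k)                          ≡⟨ nat*inverse k ⟩
  1ℚ                                                     ∎
  where open ≡-Reasoning

isProb-uniform : ∀ (L : Subset n) {k} → ∣ L ∣ ≡ suc k → IsProb (uniform L)
isProb-uniform L ∣L∣≡1+k = record
  { weights-nonneg = AllP.map⁺ (All.universal (λ _ → ratio-nonneg 1 ∣ L ∣) (elems L))
  ; mass-one       = trans (Ex-uniform L (λ _ → 1ℚ)) (average-one L ∣L∣≡1+k)
  }

module Run {m n} (E : BiGraph m n) where

  coin : Subset n → Fin m → Fin m → ℚ
  coin R ℓ₁ ℓ₂ = coinProb (∣ Nb E R ℓ₁ ∩ Nb E R ℓ₂ ∣) (∣ Nb E R ℓ₂ ─ Nb E R ℓ₁ ∣)

  coin-nonneg : ∀ R c x → 0ℚ ≤ coin R c x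
  coin-nonneg R c x = coinProb-nonneg (∣ Nb E R c ∩ Nb E R x ∣) (∣ Nb E R x ─ Nb E R c ∣)

  coin≤1 : ∀ R c x → coin R c x ≤ 1ℚ
  coin≤1 R c x = coinProb≤1 (∣ Nb E R c ∩ Nb E R x ∣) (∣ Nb E R x ─ Nb E R c ∣)

  isProb-coins : ∀ R c ls → IsProb (coins E R c ls)
  isProb-coins R c []       = isProb-return ∅
  isProb-coins R c (x ∷ ls) = isProb-bind (isProb-coins R c ls) λ S →
    isProb-bind (isProb-bernoulli (coin-nonneg R c x) (coin≤1 R c x)) λ b → isProb-return (if b then S ∪ ⁅ x ⁆ else S)

  roundCoins : Subset m → Subset n → Fin m → Dist (Subset m)
  roundCoins L R c = coins E R c (elems (L ─ ⁅ c ⁆))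

  nextLeft : Subset m → Fin m → Subset m → Subset m
  nextLeft L c S = (L ─ ⁅ c ⁆) ─ S

  nextRight : Subset n → Fin m → Subset n
  nextRight R c = R ─ Nb E R c

  isProb-run : ∀ f L R → IsProb (run E f L R)
  isProb-run zero    L R = isProb-return []
  isProb-run (suc f) L R with ∣ L ∣ in ∣L∣≡
  ... | zero  = isProb-return []
  ... | suc k = isProb-bind (isProb-uniform L ∣L∣≡) λ c → isProb-bind (isProb-coins R c (elems (L ─ ⁅ c ⁆))) λ S →
    isProb-bind (isProb-run f (nextLeft L c S) (nextRight R c)) λ rest → isProb-return (step c L R ∷ rest)

  Ex-coins-∷ : ∀ R c h ls F → Ex (coins E R c (h ∷ ls)) F
    ≡ Ex (coins E R c ls) (λ S → coin R c h * F (S ∪ ⁅ h ⁆) + (1ℚ - coin R c h) * F S)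
  Ex-coins-∷ R c h ls F = trans (Ex-bind (coins E R c ls) (λ S → bernoulli p >>= outcome S) F) (Ex-cong (coins E R c ls) λ S →
    trans (Ex-bind (bernoulli p) (outcome S) F) (trans (Ex-bernoulli p (λ b → Ex (outcome S b) F))
      (cong₂ (λ x y → p * x + (1ℚ - p) * y) (Ex-return (S ∪ ⁅ h ⁆) F) (Ex-return S F))))
    where
    p : ℚ
    p = coin R c h
    outcome : Subset m → Bool → Dist (Subset m)
    outcome S b = return (if b then S ∪ ⁅ h ⁆ else S)

  module _ (ℓ : Fin m) where

    kept : Subset m → ℚ
    kept S = ind (not (mem ℓ S))

    kept-∪ : ∀ S h → kept (S ∪ ⁅ h ⁆) ≡ ind (not (mem ℓ S ∨ eqFin ℓ h))
    kept-∪ S h = cong (λ x → ind (not x)) (trans (mem-∪ ℓ S ⁅ h ⁆) (cong (mem ℓ S ∨_) (mem-⁅⁆ ℓ h)))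

    coins-keep : ∀ R c ls → ℓ ListMem.∈ ls → Ex (coins E R c ls) kept ≤ 1ℚ - coin R c ℓ
    coins-keep R c (h ∷ ls) (here refl) = begin
      Ex (coins E R c (ℓ ∷ ls)) kept
        ≡⟨ Ex-coins-∷ R c ℓ ls kept ⟩
      Ex (coins E R c ls) (λ S → p * kept (S ∪ ⁅ ℓ ⁆) + (1ℚ - p) * kept S)
        ≡⟨ Ex-cong (coins E R c ls) (λ S → cong (λ x → p * x + (1ℚ - p) * kept S) (removed S)) ⟩
      Ex (coins E R c ls) (λ S → p * 0ℚ + (1ℚ - p) * kept S)
        ≡⟨ Ex-cong (coins E R c ls) (λ S → trans (cong (_+ (1ℚ - p) * kept S) (*-zeroʳ p)) (+-identityˡ _)) ⟩
      Ex (coins E R c ls) (λ S → (1ℚ - p) * kept S)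
        ≡⟨ Ex-*ˡ (coins E R c ls) (1ℚ - p) kept ⟩
      (1ℚ - p) * Ex (coins E R c ls) kept
        ≤⟨ *-monoˡ-nonneg (0≤1-p (coin≤1 R c ℓ)) (Ex-≤-const (isProb-coins R c ls) 1ℚ (λ S → when≤ (not (mem ℓ S)) 0≤1)) ⟩
      (1ℚ - p) * 1ℚ
        ≡⟨ *-identityʳ _ ⟩
      1ℚ - p ∎
      where
      open ≤-Reasoning
      p : ℚ
      p = coin R c ℓ
      removed : ∀ S → kept (S ∪ ⁅ ℓ ⁆) ≡ 0ℚ
      removed S = trans (kept-∪ S ℓ)
        (cong (λ x → ind (not x)) (trans (cong (mem ℓ S ∨_) (eqFin-refl ℓ)) (BoolP.∨-zeroʳ (mem ℓ S))))
    coins-keep R c (h ∷ ls) (there ℓ∈ls) = begin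
      Ex (coins E R c (h ∷ ls)) kept
        ≡⟨ Ex-coins-∷ R c h ls kept ⟩
      Ex (coins E R c ls) (λ S → p * kept (S ∪ ⁅ h ⁆) + (1ℚ - p) * kept S)
        ≤⟨ Ex-mono (isProb-coins R c ls) (λ S → +-monoˡ-≤ _ (*-monoˡ-nonneg (coin-nonneg R c h) (kept-mono S))) ⟩
      Ex (coins E R c ls) (λ S → p * kept S + (1ℚ - p) * kept S)
        ≡⟨ Ex-cong (coins E R c ls) (λ S → trans (sym (*-distribʳ-+ (kept S) p (1ℚ - p)))
                                            (trans (cong (_* kept S) (p+[1-p] p)) (*-identityˡ (kept S)))) ⟩
      Ex (coins E R c ls) kept
        ≤⟨ coins-keep R c ls ℓ∈ls ⟩
      1ℚ - coin R c ℓ ∎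
      where
      open ≤-Reasoning
      p : ℚ
      p = coin R c h
      kept-mono : ∀ S → kept (S ∪ ⁅ h ⁆) ≤ kept S
      kept-mono S = ≤-trans (≤-reflexive (kept-∪ S h)) (fewer (mem ℓ S) (eqFin ℓ h))
        where
        fewer : ∀ x y → ind (not (x ∨ y)) ≤ ind (not x)
        fewer true  y = ≤-refl
        fewer false y = when≤ (not y) 0≤1

  totalCharge : (Step m n → ℚ) → List (Step m n) → ℚ
  totalCharge ch tr = ∑ tr ch

  IsPotential : (Step m n → ℚ) → (Subset m → Subset n → ℚ) → Set
  IsPotential ch Φ = ∀ L R {k} → ∣ L ∣ ≡ suc k →
    Ex (uniform L) (λ c → ch (step c L R) + Ex (roundCoins L R c) (λ S → Φ (nextLeft L c S) (nextRight R c)))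
      ≤ Φ L R

  Ex-prepend : ∀ ch s {d} → IsProb d →
    Ex (d >>= λ rest → return (s ∷ rest)) (totalCharge ch) ≡ ch s + Ex d (totalCharge ch)
  Ex-prepend ch s {d} prob = trans (Ex-bind d _ _)
    (trans (Ex-cong d (λ rest → Ex-return (s ∷ rest) (totalCharge ch))) (Ex-const-+ prob (ch s) _))

  run-potential : ∀ {ch Φ} → (∀ L R → 0ℚ ≤ Φ L R) → IsPotential ch Φ →
    ∀ f L R → Ex (run E f L R) (totalCharge ch) ≤ Φ L R
  run-potential {ch} Φ≥0 pot zero L R = ≤-trans (≤-reflexive (Ex-return [] (totalCharge ch))) (Φ≥0 L R)
  run-potential {ch} {Φ} Φ≥0 pot (suc f) L R with ∣ L ∣ in ∣L∣≡
  ... | zero  = ≤-trans (≤-reflexive (Ex-return [] (totalCharge ch))) (Φ≥0 L R)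
  ... | suc k = ≤-trans (≤-reflexive (Ex-bind (uniform L) (λ c → roundCoins L R c >>= rest-of-run c) (totalCharge ch)))
                  (≤-trans (Ex-mono (isProb-uniform L ∣L∣≡) round) (pot L R ∣L∣≡))
    where
    rest-of-run : Fin m → Subset m → Dist (List (Step m n))
    rest-of-run c S = run E f (nextLeft L c S) (nextRight R c) >>= λ rest → return (step c L R ∷ rest)

    round : ∀ c → Ex (roundCoins L R c >>= rest-of-run c) (totalCharge ch)
                  ≤ ch (step c L R) + Ex (roundCoins L R c) (λ S → Φ (nextLeft L c S) (nextRight R c))
    round c = begin
      Ex (roundCoins L R c >>= rest-of-run c) (totalCharge ch)
        ≡⟨ Ex-bind (roundCoins L R c) (rest-of-run c) _ ⟩
      Ex (roundCoins L R c) (λ S → Ex (rest-of-run c S) (totalCharge ch))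
        ≡⟨ Ex-cong (roundCoins L R c) (λ S → Ex-prepend ch (step c L R) (isProb-run f (nextLeft L c S) (nextRight R c))) ⟩
      Ex (roundCoins L R c) (λ S → ch (step c L R) + Ex (run E f (nextLeft L c S) (nextRight R c)) (totalCharge ch))
        ≤⟨ Ex-mono coins-prob (λ S → +-monoʳ-≤ (ch (step c L R)) (run-potential Φ≥0 pot f _ _)) ⟩
      Ex (roundCoins L R c) (λ S → ch (step c L R) + Φ (nextLeft L c S) (nextRight R c))
        ≡⟨ Ex-const-+ coins-prob (ch (step c L R)) _ ⟩
      ch (step c L R) + Ex (roundCoins L R c) (λ S → Φ (nextLeft L c S) (nextRight R c)) ∎
      where
      open ≤-Reasoning
      coins-prob : IsProb (roundCoins L R c)
      coins-prob = isProb-coins R c (elems (L ─ ⁅ c ⁆))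

module Charges {m n} (E : BiGraph m n) where
  open Run E

  stepTuple : Subset n → Fin m → Fin m → Tuple m n
  stepTuple R c b = tuple c b (Nb E R c ─ Nb E R b) (Nb E R c ∩ Nb E R b) (Nb E R b ─ Nb E R c)

  -- the charge of a round for tuple weights K: the total weight of the
  -- tuples whose bad event happens in this round
  charge : (Tuple m n → ℚ) → Step m n → ℚ
  charge K (step c L R) = ∑ (allFin m) (λ b → when (mem b L) (K (stepTuple R c b)))

  allTuples : List (Tuple m n)
  allTuples = concatMap (λ a → concatMap (λ b → concatMap (λ r1 → concatMap (λ r12 → map (λ r2 →
      tuple a b r1 r12 r2) (allSubsets n)) (allSubsets n)) (allSubsets n)) (allFin m)) (allFin m)

  ∑-allTuples : ∀ F → ∑ allTuples F ≡
    ∑ (allFin m) λ a → ∑ (allFin m) λ b → ∑ (allSubsets n) λ r₁ → ∑ (allSubsets n) λ r₁₂ → ∑ (allSubsets n) λ r₂ →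
      F (tuple a b r₁ r₁₂ r₂)
  ∑-allTuples F =
    trans (∑-concatMap _ (allFin m) F) (∑-cong (allFin m) λ a →
    trans (∑-concatMap _ (allFin m) F) (∑-cong (allFin m) λ b →
    trans (∑-concatMap _ (allSubsets n) F) (∑-cong (allSubsets n) λ r₁ →
    trans (∑-concatMap _ (allSubsets n) F) (∑-cong (allSubsets n) λ r₁₂ →
    ∑-map (tuple a b r₁ r₁₂) (allSubsets n) F))))

  ∑-collapseSub-guarded : ∀ bs (X : Subset n) g →
    ∑ (allSubsets n) (λ s → guard bs (when (eqSub s X) (g s))) ≡ guard bs (g X)
  ∑-collapseSub-guarded bs X g = trans (∑-guard (allSubsets n) bs _) (cong (guard bs) (∑-collapseSub X g))

  -- In a given round, the bad event of exactly the tuples (c , b , …) with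
  -- b remaining occurs, so the weights of these events add up to the charge.
  step-collapse : ∀ K s → ∑ allTuples (λ T → when (XStep E T s) (K T)) ≡ charge K s
  step-collapse K (step c L R) = begin
    ∑ allTuples (λ T → when (XStep E T (step c L R)) (K T))
      ≡⟨ ∑-allTuples _ ⟩
    (∑ Fs λ a → ∑ Fs λ b → ∑ Ss λ r₁ → ∑ Ss λ r₁₂ → ∑ Ss λ r₂ →
      when (XStep E (tuple a b r₁ r₁₂ r₂) (step c L R)) (K (tuple a b r₁ r₁₂ r₂)))
      ≡⟨ (∑-cong Fs λ a → ∑-cong Fs λ b → ∑-cong Ss λ r₁ → ∑-cong Ss λ r₁₂ → ∑-cong Ss λ r₂ →
           when-⋀ (eqFin c a ∷ mem b L ∷ eqSub r₁ (Y₁ a b) ∷ eqSub r₁₂ (Y₁₂ a b) ∷ []) (eqSub r₂ (Y₂ a b)) _) ⟩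
    (∑ Fs λ a → ∑ Fs λ b → ∑ Ss λ r₁ → ∑ Ss λ r₁₂ → ∑ Ss λ r₂ →
      guard (eqFin c a ∷ mem b L ∷ eqSub r₁ (Y₁ a b) ∷ eqSub r₁₂ (Y₁₂ a b) ∷ [])
        (when (eqSub r₂ (Y₂ a b)) (K (tuple a b r₁ r₁₂ r₂))))
      ≡⟨ (∑-cong Fs λ a → ∑-cong Fs λ b → ∑-cong Ss λ r₁ → ∑-cong Ss λ r₁₂ →
           ∑-collapseSub-guarded (eqFin c a ∷ mem b L ∷ eqSub r₁ (Y₁ a b) ∷ eqSub r₁₂ (Y₁₂ a b) ∷ []) (Y₂ a b) _) ⟩
    (∑ Fs λ a → ∑ Fs λ b → ∑ Ss λ r₁ → ∑ Ss λ r₁₂ →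
      guard (eqFin c a ∷ mem b L ∷ eqSub r₁ (Y₁ a b) ∷ []) (when (eqSub r₁₂ (Y₁₂ a b)) (K (tuple a b r₁ r₁₂ (Y₂ a b)))))
      ≡⟨ (∑-cong Fs λ a → ∑-cong Fs λ b → ∑-cong Ss λ r₁ →
           ∑-collapseSub-guarded (eqFin c a ∷ mem b L ∷ eqSub r₁ (Y₁ a b) ∷ []) (Y₁₂ a b) _) ⟩
    (∑ Fs λ a → ∑ Fs λ b → ∑ Ss λ r₁ →
      guard (eqFin c a ∷ mem b L ∷ []) (when (eqSub r₁ (Y₁ a b)) (K (tuple a b r₁ (Y₁₂ a b) (Y₂ a b)))))
      ≡⟨ (∑-cong Fs λ a → ∑-cong Fs λ b → ∑-collapseSub-guarded (eqFin c a ∷ mem b L ∷ []) (Y₁ a b) _) ⟩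
    (∑ Fs λ a → ∑ Fs λ b → when (eqFin c a) (when (mem b L) (K (stepTuple R a b))))
      ≡⟨ (∑-cong Fs λ a → ∑-when Fs (eqFin c a) _) ⟩
    (∑ Fs λ a → when (eqFin c a) (∑ Fs λ b → when (mem b L) (K (stepTuple R a b))))
      ≡⟨ ∑-collapseFin′ c _ ⟩
    charge K (step c L R) ∎
    where
    open ≡-Reasoning
    Fs : List (Fin m)
    Fs = allFin m
    Ss : List (Subset n)
    Ss = allSubsets n
    Y₁ Y₁₂ Y₂ : Fin m → Fin m → Subset n
    Y₁  a b = Nb E R a ─ Nb E R b
    Y₁₂ a b = Nb E R a ∩ Nb E R b
    Y₂  a b = Nb E R b ─ Nb E R a

  XT≤∑XStep : ∀ T tr {k} → 0ℚ ≤ k → when (XT E T tr) k ≤ ∑ tr (λ s → when (XStep E T s) k)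
  XT≤∑XStep T []       0≤k = ≤-refl
  XT≤∑XStep T (s ∷ tr) 0≤k =
    ≤-trans (when-∨ (XStep E T s) (XT E T tr) 0≤k) (+-monoʳ-≤ (when (XStep E T s) _) (XT≤∑XStep T tr 0≤k))

  isProb-pivot : IsProb (pivotBiCluster E)
  isProb-pivot = isProb-run m (replicate m true) (replicate n true)

  ∑q≤expected-charge : ∀ K → (∀ T → 0ℚ ≤ K T) →
    ∑ (tuples E) (λ T → K T * q E T) ≤ Ex (pivotBiCluster E) (totalCharge (charge K))
  ∑q≤expected-charge K K≥0 = begin
    ∑ (tuples E) (λ T → K T * q E T)
      ≡⟨ ∑-filter (validTuple E) allTuples _ ⟩
    ∑ allTuples (λ T → when (validTuple E T) (K T * q E T))
      ≤⟨ ∑-mono allTuples (λ T → when≤ (validTuple E T) (*-nonneg (K≥0 T) (Pr-nonneg isProb-pivot (XT E T)))) ⟩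
    ∑ allTuples (λ T → K T * q E T)
      ≡⟨ ∑-cong allTuples (λ T → *-Pr D (XT E T) (K T)) ⟩
    ∑ allTuples (λ T → Ex D (λ tr → when (XT E T tr) (K T)))
      ≡⟨ ∑-Ex D allTuples (λ T tr → when (XT E T tr) (K T)) ⟩
    Ex D (λ tr → ∑ allTuples (λ T → when (XT E T tr) (K T)))
      ≤⟨ Ex-mono isProb-pivot (λ tr → ∑-mono allTuples (λ T → XT≤∑XStep T tr (K≥0 T))) ⟩
    Ex D (λ tr → ∑ allTuples (λ T → ∑ tr (λ s → when (XStep E T s) (K T))))
      ≡⟨ Ex-cong D (λ tr → trans (∑-swap allTuples tr _) (∑-cong tr (step-collapse K))) ⟩
    Ex D (totalCharge (charge K)) ∎
    where
    open ≤-Reasoning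
    D : Dist (List (Step m n))
    D = pivotBiCluster E

  ∑q≤potential : ∀ K {Φ} → (∀ T → 0ℚ ≤ K T) → (∀ L R → 0ℚ ≤ Φ L R) → IsPotential (charge K) Φ →
    ∑ (tuples E) (λ T → K T * q E T) ≤ Φ (replicate m true) (replicate n true)
  ∑q≤potential K K≥0 Φ≥0 pot = ≤-trans (∑q≤expected-charge K K≥0) (run-potential Φ≥0 pot m _ _)

-- The coefficient α of a tuple with |R₁| = a, |R₁₂| = s, |R₂| = b.
αcoef : ℕ → ℕ → ℕ → ℚ
αcoef a s b = 1ℚ ⊓ ratio s (minℕ s a ℕ.+ minℕ s b)

-- The weight β(T)/q_T of such a tuple.
weight : ℕ → ℕ → ℕ → ℚ
weight a zero    b = 0ℚ
weight a (suc s) b = αcoef a (suc s) b * nat (minℕ (suc s) b)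

tupleWeight : ∀ {m n} → Tuple m n → ℚ
tupleWeight T = weight (∣ R₁ T ∣) (∣ R₁₂ T ∣) (∣ R₂ T ∣)

β-factor : ∀ {m n} (E : BiGraph m n) T → β E T ≡ tupleWeight T * q E T
β-factor E T with ∣ R₁₂ T ∣ in ∣R₁₂∣≡
... | zero  = sym (*-zeroˡ (q E T))
... | suc s = subst (λ t → αcoef a t b * q E T * nat (minℕ t b) ≡ weight a (suc s) b * q E T) (sym ∣R₁₂∣≡)
                (*-swapʳ (αcoef a (suc s) b) (q E T) (nat (minℕ (suc s) b)))
  where
  a b : ℕ
  a = ∣ R₁ T ∣
  b = ∣ R₂ T ∣
  *-swapʳ : ∀ x y z → x * y * z ≡ x * z * y
  *-swapʳ = solve 3 (λ x y z → x :* y :* z := x :* z :* y) refl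

weight-nonneg : ∀ a s b → 0ℚ ≤ weight a s b
weight-nonneg a zero    b = ≤-refl
weight-nonneg a (suc s) b = *-nonneg (⊓-glb 0≤1 (ratio-nonneg (suc s) (minℕ (suc s) a ℕ.+ minℕ (suc s) b))) (ratio-nonneg (minℕ (suc s) b) 1)

weight-share≤coin : ∀ a s b → weight a s b * ratio 1 b ≤ coinProb s b
weight-share≤coin a zero    b = ≤-trans (≤-reflexive (*-zeroˡ (ratio 1 b))) (coinProb-nonneg 0 b)
weight-share≤coin a (suc s) b = begin
  αcoef a (suc s) b * nat (minℕ (suc s) b) * ratio 1 b    ≡⟨ *-assoc (αcoef a (suc s) b) _ _ ⟩
  αcoef a (suc s) b * (nat (minℕ (suc s) b) * ratio 1 b)  ≤⟨ *-monoʳ-nonneg share-nonneg (p⊓q≤p 1ℚ (ratio (suc s) (minℕ (suc s) a ℕ.+ minℕ (suc s) b))) ⟩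
  1ℚ * (nat (minℕ (suc s) b) * ratio 1 b)                 ≡⟨ *-identityˡ _ ⟩
  nat (minℕ (suc s) b) * ratio 1 b                        ≡⟨ nat*ratio1 (minℕ (suc s) b) b ⟩
  ratio (minℕ (suc s) b) b                                ≤⟨ min-ratio≤coin b ⟩
  coinProb (suc s) b                                      ∎
  where
  open ≤-Reasoning
  share-nonneg : 0ℚ ≤ nat (minℕ (suc s) b) * ratio 1 b
  share-nonneg = *-nonneg (ratio-nonneg (minℕ (suc s) b) 1) (ratio-nonneg 1 b)
  min-ratio≤coin : ∀ b → ratio (minℕ (suc s) b) b ≤ coinProb (suc s) b
  min-ratio≤coin b with b ℕ.≤? suc s
  ... | yes _   = ratio≤1 _ b (ℕP.m⊓n≤n (suc s) b)
  ... | no  b≰s = ≤-reflexive (cong (λ t → ratio t b) (ℕP.m≤n⇒m⊓n≡m (ℕP.<⇒≤ (ℕP.≰⇒> b≰s))))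

weight-share≤1 : ∀ a s b → weight a s b * ratio 1 b ≤ 1ℚ
weight-share≤1 a s b = ≤-trans (weight-share≤coin a s b) (coinProb≤1 s b)

αscaled≤1 : ∀ s t → (1ℚ ⊓ ratio (suc s) t) * (nat t * ratio 1 (suc s)) ≤ 1ℚ
αscaled≤1 s zero    = ≤-trans (≤-reflexive (trans (cong (α₀ *_) (*-zeroˡ (ratio 1 (suc s)))) (*-zeroʳ α₀))) 0≤1
  where
  α₀ : ℚ
  α₀ = 1ℚ ⊓ ratio (suc s) 0
αscaled≤1 s (suc t) = begin
  (1ℚ ⊓ ratio (suc s) (suc t)) * (nat (suc t) * r)   ≤⟨ *-monoʳ-nonneg (*-nonneg (ratio-nonneg (suc t) 1) (ratio-nonneg 1 (suc s))) (p⊓q≤q 1ℚ (ratio (suc s) (suc t))) ⟩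
  ratio (suc s) (suc t) * (nat (suc t) * r)          ≡⟨ *-assoc (ratio (suc s) (suc t)) (nat (suc t)) r ⟨
  ratio (suc s) (suc t) * nat (suc t) * r            ≡⟨ cong (_* r) (ratio*nat (suc s) t) ⟩
  nat (suc s) * r                                    ≡⟨ nat*inverse s ⟩
  1ℚ                                                 ∎
  where
  open ≤-Reasoning
  r : ℚ
  r = ratio 1 (suc s)

weight-pair : ∀ a s b → s ≢ 0 → weight a s b * ratio 1 s + weight b s a * ratio 1 s ≤ 1ℚ
weight-pair a zero    b s≢0 = contradiction refl s≢0
weight-pair a (suc s) b _   = begin
  αₛ * nat mb * r + αcoef b (suc s) a * nat ma * r  ≡⟨ cong (λ y → αₛ * nat mb * r + y * nat ma * r) mirror-αₛ ⟩
  αₛ * nat mb * r + αₛ * nat ma * r                  ≡⟨ factor αₛ (nat mb) (nat ma) r ⟩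
  αₛ * ((nat ma + nat mb) * r)                      ≡⟨ cong (λ x → αₛ * (x * r)) (nat-+ ma mb) ⟨
  αₛ * (nat (ma ℕ.+ mb) * r)                        ≤⟨ αscaled≤1 s (ma ℕ.+ mb) ⟩
  1ℚ                                               ∎
  where
  open ≤-Reasoning
  ma mb : ℕ
  ma = minℕ (suc s) a
  mb = minℕ (suc s) b
  r : ℚ
  r = ratio 1 (suc s)
  αₛ : ℚ
  αₛ = αcoef a (suc s) b
  mirror-αₛ : αcoef b (suc s) a ≡ αₛ
  mirror-αₛ = cong (λ t → 1ℚ ⊓ ratio (suc s) t) (ℕP.+-comm mb ma)
  factor : ∀ c x y r → c * x * r + c * y * r ≡ c * ((y + x) * r)
  factor = solve 4 (λ c x y r → c :* x :* r :+ c :* y :* r := c :* ((y :+ x) :* r)) refl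

module Constraint {m n} (E : BiGraph m n) (ℓ : Fin m) (r : Fin n) where
  open Run E
  open Charges E

  present : Subset m → Subset n → ℚ
  present L R = ind (mem ℓ L ∧ mem r R)

  present-nonneg : ∀ L R → 0ℚ ≤ present L R
  present-nonneg L R = when-nonneg (mem ℓ L ∧ mem r R) 0≤1

  survive : Subset m → Subset n → Fin m → ℚ
  survive L R c = Ex (roundCoins L R c) (λ S → present (nextLeft L c S) (nextRight R c))

  present-next : ∀ L R c S → mem ℓ (nextLeft L c S) ∧ mem r (nextRight R c)
    ≡ ((mem ℓ L ∧ not (eqFin ℓ c)) ∧ not (mem ℓ S)) ∧ (mem r R ∧ not (mem r (Nb E R c)))
  present-next L R c S = cong₂ _∧_
    (trans (mem-─ ℓ (L ─ ⁅ c ⁆) S) (cong (_∧ not (mem ℓ S))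
      (trans (mem-─ ℓ L ⁅ c ⁆) (cong (λ x → mem ℓ L ∧ not x) (mem-⁅⁆ ℓ c)))))
    (mem-─ r R (Nb E R c))

  survive≤1 : ∀ L R c → survive L R c ≤ 1ℚ
  survive≤1 L R c = Ex-≤-const (isProb-coins R c (elems (L ─ ⁅ c ⁆))) 1ℚ
    (λ S → when≤ (mem ℓ (nextLeft L c S) ∧ mem r (nextRight R c)) 0≤1)

  survive≡0 : ∀ L R c → mem ℓ L ∧ (mem r R ∧ not (mem r (Nb E R c))) ≡ false → survive L R c ≡ 0ℚ
  survive≡0 L R c dead = Ex-zero (roundCoins L R c) λ S →
    cong ind (trans (present-next L R c S) (stays-dead (mem ℓ L) _ (not (mem ℓ S)) dead))
    where
    stays-dead : ∀ x y z {u} → x ∧ u ≡ false → ((x ∧ y) ∧ z) ∧ u ≡ false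
    stays-dead false y z h = refl
    stays-dead true  y z h = trans (cong ((y ∧ z) ∧_) h) (BoolP.∧-zeroʳ (y ∧ z))

  -- If ℓ is a candidate of the round and r is not a neighbour of the
  -- center, (ℓ , r) survives exactly when ℓ's coin fails.
  survive≤1-coin : ∀ L R c → mem ℓ L ≡ true → eqFin ℓ c ≡ false → mem r R ≡ true → mem r (Nb E R c) ≡ false →
    survive L R c ≤ 1ℚ - coin R c ℓ
  survive≤1-coin L R c ℓ∈L ℓ≢c r∈R r∉Nc = ≤-trans
    (≤-reflexive (Ex-cong (roundCoins L R c) λ S → cong ind (trans (present-next L R c S)
      (trans (cong₂ (λ x y → ((x ∧ not y) ∧ not (mem ℓ S)) ∧ (mem r R ∧ not (mem r (Nb E R c)))) ℓ∈L ℓ≢c)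
        (trans (cong₂ (λ x y → not (mem ℓ S) ∧ (x ∧ not y)) r∈R r∉Nc) (BoolP.∧-identityʳ _))))))
    (coins-keep ℓ R c (elems (L ─ ⁅ c ⁆)) ℓ-candidate)
    where
    ℓ-candidate : ℓ ListMem.∈ elems (L ─ ⁅ c ⁆)
    ℓ-candidate = ListMemP.∈-filter⁺ (λ i → lookup (L ─ ⁅ c ⁆) i Bool.≟ true) (ListMemP.∈-allFin ℓ)
      (trans (mem-─ ℓ L ⁅ c ⁆) (cong₂ (λ x y → x ∧ not y) ℓ∈L (trans (mem-⁅⁆ ℓ c) ℓ≢c)))

  SplitsAs : (K K₂ K₁ : Tuple m n → ℚ) → Set
  SplitsAs K K₂ K₁ = ∀ T → K T ≡ when (eqFin (ℓ₂ T) ℓ) (K₂ T) + when (eqFin (ℓ₁ T) ℓ) (K₁ T)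

  -- the part of the charge to (ℓ , r) attributable to the center c:
  -- ℓ is the second node of the tuple (c , ℓ) and the first of (ℓ , c)
  localCharge : (K₂ K₁ : Tuple m n → ℚ) → Subset n → Fin m → ℚ
  localCharge K₂ K₁ R c = K₂ (stepTuple R c ℓ) + K₁ (stepTuple R ℓ c)

  module _ {K K₂ K₁ : Tuple m n → ℚ} (split : SplitsAs K K₂ K₁) where

    charge-split : ∀ c L R → charge K (step c L R)
      ≡ when (mem ℓ L) (K₂ (stepTuple R c ℓ)) + when (eqFin c ℓ) (∑ (allFin m) (λ b → when (mem b L) (K₁ (stepTuple R c b))))
    charge-split c L R = begin
      ∑ Fs (λ b → when (mem b L) (K (T c b)))
        ≡⟨ ∑-cong Fs (λ b → trans (cong (when (mem b L)) (split (T c b)))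
             (trans (when-+ (mem b L) _ _) (cong₂ _+_ (when-comm (mem b L) (eqFin b ℓ) _) (when-comm (mem b L) (eqFin c ℓ) _)))) ⟩
      ∑ Fs (λ b → when (eqFin b ℓ) (when (mem b L) (K₂ (T c b))) + when (eqFin c ℓ) (when (mem b L) (K₁ (T c b))))
        ≡⟨ ∑-+ Fs _ _ ⟩
      ∑ Fs (λ b → when (eqFin b ℓ) (when (mem b L) (K₂ (T c b)))) + ∑ Fs (λ b → when (eqFin c ℓ) (when (mem b L) (K₁ (T c b))))
        ≡⟨ cong₂ _+_ (∑-collapseFin ℓ (λ b → when (mem b L) (K₂ (T c b)))) (∑-when Fs (eqFin c ℓ) _) ⟩
      when (mem ℓ L) (K₂ (T c ℓ)) + when (eqFin c ℓ) (∑ Fs (λ b → when (mem b L) (K₁ (T c b)))) ∎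
      where
      open ≡-Reasoning
      Fs : List (Fin m)
      Fs = allFin m
      T : Fin m → Fin m → Tuple m n
      T = stepTuple R

    charge-exchange : ∀ L R → ∑ (allFin m) (λ c → when (mem c L) (charge K (step c L R)))
      ≡ ∑ (allFin m) (λ c → when (mem c L) (when (mem ℓ L) (localCharge K₂ K₁ R c)))
    charge-exchange L R = begin
      ∑ Fs (λ c → when (mem c L) (charge K (step c L R)))
        ≡⟨ ∑-cong Fs (λ c → trans (cong (when (mem c L)) (charge-split c L R)) (when-+ (mem c L) _ _)) ⟩
      ∑ Fs (λ c → when (mem c L) (when (mem ℓ L) (K₂ (T c ℓ))) + when (mem c L) (when (eqFin c ℓ) (W c)))
        ≡⟨ ∑-+ Fs _ _ ⟩
      ∑ Fs (λ c → when (mem c L) (when (mem ℓ L) (K₂ (T c ℓ)))) + ∑ Fs (λ c → when (mem c L) (when (eqFin c ℓ) (W c)))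
        ≡⟨ cong (∑ Fs (λ c → when (mem c L) (when (mem ℓ L) (K₂ (T c ℓ)))) +_) second-role ⟩
      ∑ Fs (λ c → when (mem c L) (when (mem ℓ L) (K₂ (T c ℓ)))) + ∑ Fs (λ c → when (mem c L) (when (mem ℓ L) (K₁ (T ℓ c))))
        ≡⟨ ∑-+ Fs _ _ ⟨
      ∑ Fs (λ c → when (mem c L) (when (mem ℓ L) (K₂ (T c ℓ))) + when (mem c L) (when (mem ℓ L) (K₁ (T ℓ c))))
        ≡⟨ ∑-cong Fs (λ c → trans (sym (when-+ (mem c L) _ _)) (cong (when (mem c L)) (sym (when-+ (mem ℓ L) _ _)))) ⟩
      ∑ Fs (λ c → when (mem c L) (when (mem ℓ L) (localCharge K₂ K₁ R c))) ∎
      where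
      open ≡-Reasoning
      Fs : List (Fin m)
      Fs = allFin m
      T : Fin m → Fin m → Tuple m n
      T = stepTuple R
      W : Fin m → ℚ
      W c = ∑ Fs (λ b → when (mem b L) (K₁ (T c b)))
      -- the centers c = ℓ contribute the tuples (ℓ , b), renamed (ℓ , c)
      second-role : ∑ Fs (λ c → when (mem c L) (when (eqFin c ℓ) (W c))) ≡ ∑ Fs (λ c → when (mem c L) (when (mem ℓ L) (K₁ (T ℓ c))))
      second-role = begin
        ∑ Fs (λ c → when (mem c L) (when (eqFin c ℓ) (W c)))   ≡⟨ ∑-cong Fs (λ c → when-comm (mem c L) (eqFin c ℓ) (W c)) ⟩
        ∑ Fs (λ c → when (eqFin c ℓ) (when (mem c L) (W c)))   ≡⟨ ∑-collapseFin ℓ (λ c → when (mem c L) (W c)) ⟩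
        when (mem ℓ L) (W ℓ)                                   ≡⟨ ∑-when Fs (mem ℓ L) _ ⟨
        ∑ Fs (λ c → when (mem ℓ L) (when (mem c L) (K₁ (T ℓ c)))) ≡⟨ ∑-cong Fs (λ c → when-comm (mem ℓ L) (mem c L) _) ⟩
        ∑ Fs (λ c → when (mem c L) (when (mem ℓ L) (K₁ (T ℓ c)))) ∎

    present-potential :
      (∀ L R c → mem ℓ L ≡ true → mem r R ≡ true → localCharge K₂ K₁ R c + survive L R c ≤ 1ℚ) →
      (∀ R c → mem r R ≡ false → localCharge K₂ K₁ R c ≡ 0ℚ) →
      IsPotential (charge K) present
    present-potential alive gone L R ∣L∣≡ = begin
      Ex (uniform L) (λ c → charge K (step c L R) + survive L R c)
        ≡⟨ Ex-uniform L _ ⟩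
      ratio 1 ∣ L ∣ * ∑ Fs (λ c → when (mem c L) (charge K (step c L R) + survive L R c))
        ≡⟨ cong (ratio 1 ∣ L ∣ *_) (begin-equality
             ∑ Fs (λ c → when (mem c L) (charge K (step c L R) + survive L R c))
               ≡⟨ trans (∑-cong Fs (λ c → when-+ (mem c L) _ _)) (∑-+ Fs _ _) ⟩
             ∑ Fs (λ c → when (mem c L) (charge K (step c L R))) + ∑ Fs (λ c → when (mem c L) (survive L R c))
               ≡⟨ cong (_+ ∑ Fs (λ c → when (mem c L) (survive L R c))) (charge-exchange L R) ⟩
             ∑ Fs (λ c → when (mem c L) (when (mem ℓ L) (localCharge K₂ K₁ R c))) + ∑ Fs (λ c → when (mem c L) (survive L R c))
               ≡⟨ trans (sym (∑-+ Fs _ _)) (∑-cong Fs (λ c → sym (when-+ (mem c L) _ _))) ⟩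
             ∑ Fs (λ c → when (mem c L) (when (mem ℓ L) (localCharge K₂ K₁ R c) + survive L R c)) ∎) ⟩
      ratio 1 ∣ L ∣ * ∑ Fs (λ c → when (mem c L) (when (mem ℓ L) (localCharge K₂ K₁ R c) + survive L R c))
        ≤⟨ average≤present (mem ℓ L) refl (mem r R) refl ⟩
      present L R ∎
      where
      open ≤-Reasoning
      Fs : List (Fin m)
      Fs = allFin m
      vanishing : (∀ c → when (mem ℓ L) (localCharge K₂ K₁ R c) + survive L R c ≡ 0ℚ) →
        ratio 1 ∣ L ∣ * ∑ Fs (λ c → when (mem c L) (when (mem ℓ L) (localCharge K₂ K₁ R c) + survive L R c)) ≡ 0ℚ
      vanishing zero-term = trans (cong (ratio 1 ∣ L ∣ *_)
        (trans (∑-cong Fs (λ c → trans (cong (when (mem c L)) (zero-term c)) (when-zero (mem c L)))) (∑-zero Fs)))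
        (*-zeroʳ (ratio 1 ∣ L ∣))
      average≤present : ∀ x → mem ℓ L ≡ x → ∀ y → mem r R ≡ y →
        ratio 1 ∣ L ∣ * ∑ Fs (λ c → when (mem c L) (when (mem ℓ L) (localCharge K₂ K₁ R c) + survive L R c)) ≤ present L R
      average≤present false ℓ∉L y r∈?R = ≤-trans (≤-reflexive (vanishing λ c →
        trans (cong₂ (λ x s → when x (localCharge K₂ K₁ R c) + s) ℓ∉L (survive≡0 L R c (cong (_∧ _) ℓ∉L))) (+-identityʳ 0ℚ)))
        (present-nonneg L R)
      average≤present true ℓ∈L false r∉R = ≤-trans (≤-reflexive (vanishing λ c →
        trans (cong₂ (λ x s → when (mem ℓ L) x + s) (gone R c r∉R)
                (survive≡0 L R c (trans (cong (λ u → mem ℓ L ∧ (u ∧ not (mem r (Nb E R c)))) r∉R) (BoolP.∧-zeroʳ (mem ℓ L)))))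
          (trans (+-identityʳ _) (when-zero (mem ℓ L)))))
        (present-nonneg L R)
      average≤present true ℓ∈L true r∈R = begin
        ratio 1 ∣ L ∣ * ∑ Fs (λ c → when (mem c L) (when (mem ℓ L) (localCharge K₂ K₁ R c) + survive L R c))
          ≤⟨ *-monoˡ-nonneg (ratio-nonneg 1 ∣ L ∣) (∑-mono Fs (λ c → when-mono (mem c L)
               (≤-trans (≤-reflexive (cong (λ x → when x (localCharge K₂ K₁ R c) + survive L R c) ℓ∈L)) (alive L R c ℓ∈L r∈R)))) ⟩
        ratio 1 ∣ L ∣ * ∑ Fs (λ c → when (mem c L) 1ℚ)
          ≡⟨ average-one L ∣L∣≡ ⟩
        1ℚ
          ≡⟨ cong₂ (λ x y → ind (x ∧ y)) ℓ∈L r∈R ⟨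
        present L R ∎

    constraint-bound : (∀ T → 0ℚ ≤ K T) →
      (∀ L R c → mem ℓ L ≡ true → mem r R ≡ true → localCharge K₂ K₁ R c + survive L R c ≤ 1ℚ) →
      (∀ R c → mem r R ≡ false → localCharge K₂ K₁ R c ≡ 0ℚ) →
      ∑ (tuples E) (λ T → K T * q E T) ≤ 1ℚ
    constraint-bound K≥0 alive gone =
      ≤-trans (∑q≤potential K K≥0 present-nonneg (present-potential alive gone)) (when≤ _ 0≤1)

  share₂ share₁₂ : Tuple m n → ℚ
  share₂  T = tupleWeight T * ratio 1 ∣ R₂ T ∣
  share₁₂ T = tupleWeight T * ratio 1 ∣ R₁₂ T ∣

  share-nonneg : ∀ (T : Tuple m n) k → 0ℚ ≤ tupleWeight T * ratio 1 k
  share-nonneg T k = *-nonneg (weight-nonneg (∣ R₁ T ∣) (∣ R₁₂ T ∣) (∣ R₂ T ∣)) (ratio-nonneg 1 k)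

  when-β : ∀ b T k → when b (β E T * ratio 1 k) ≡ when b (tupleWeight T * ratio 1 k) * q E T
  when-β b T k = begin
    when b (β E T * ratio 1 k)                     ≡⟨ cong (λ x → when b (x * ratio 1 k)) (β-factor E T) ⟩
    when b (tupleWeight T * q E T * ratio 1 k)     ≡⟨ cong (when b) (*-swapʳ (tupleWeight T) (q E T) (ratio 1 k)) ⟩
    when b (tupleWeight T * ratio 1 k * q E T)     ≡⟨ when-* b _ (q E T) ⟨
    when b (tupleWeight T * ratio 1 k) * q E T     ∎
    where
    open ≡-Reasoning
    *-swapʳ : ∀ x y z → x * y * z ≡ x * z * y
    *-swapʳ = solve 3 (λ x y z → x :* y :* z := x :* z :* y) refl

  distinct : ∀ {R x y} → mem r (Nb E R x) ≡ true → mem r (Nb E R y) ≡ false → eqFin x y ≡ false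
  distinct {x = x} {y} r∈Nx r∉Ny with x ≟ y
  ... | yes refl = contradiction (trans (sym r∈Nx) r∉Ny) λ ()
  ... | no  _    = refl

  gone-Nb : ∀ {R} x → mem r R ≡ false → mem r (Nb E R x) ≡ false
  gone-Nb {R} x r∉R = trans (mem-∩ r (E x) R) (trans (cong (mem r (E x) ∧_) r∉R) (BoolP.∧-zeroʳ _))

  gone-─ : ∀ {R} x y → mem r R ≡ false → mem r (Nb E R x ─ Nb E R y) ≡ false
  gone-─ {R} x y r∉R = trans (mem-─ r (Nb E R x) (Nb E R y)) (cong (_∧ not (mem r (Nb E R y))) (gone-Nb x r∉R))

  gone-∩ : ∀ {R} x y → mem r R ≡ false → mem r (Nb E R x ∩ Nb E R y) ≡ false
  gone-∩ {R} x y r∉R = trans (mem-∩ r (Nb E R x) (Nb E R y)) (cong (_∧ mem r (Nb E R y)) (gone-Nb x r∉R))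

  size≢0 : ∀ {k} (i : Fin k) p → mem i p ≡ true → ∣ p ∣ ≢ 0
  size≢0 zero    (true  ∷ p) _   ()
  size≢0 (suc i) (true  ∷ p) _   ()
  size≢0 (suc i) (false ∷ p) i∈p = size≢0 i p i∈p

  module Edge (r∈Eℓ : mem r (E ℓ) ≡ true) where

    K K₂ K₁ : Tuple m n → ℚ
    K T = when (eqFin (ℓ₂ T) ℓ ∧ mem r (R₂ T)) (share₂ T) + when (eqFin (ℓ₁ T) ℓ ∧ mem r (R₁₂ T)) (share₁₂ T)
        + when (eqFin (ℓ₂ T) ℓ ∧ mem r (R₁₂ T)) (share₁₂ T)
    K₂ T = when (mem r (R₂ T)) (share₂ T) + when (mem r (R₁₂ T)) (share₁₂ T)
    K₁ T = when (mem r (R₁₂ T)) (share₁₂ T)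

    split : SplitsAs K K₂ K₁
    split T = begin
      K T
        ≡⟨ cong₂ _+_ (cong₂ _+_ (when-∧ e₂ _ _) (when-∧ e₁ _ _)) (when-∧ e₂ _ _) ⟩
      when e₂ x + when e₁ y + when e₂ y
        ≡⟨ +-rearrange (when e₂ x) (when e₁ y) (when e₂ y) ⟩
      (when e₂ x + when e₂ y) + when e₁ y
        ≡⟨ cong (_+ when e₁ y) (when-+ e₂ x y) ⟨
      when e₂ (K₂ T) + when e₁ (K₁ T) ∎
      where
      open ≡-Reasoning
      e₁ e₂ : Bool
      e₁ = eqFin (ℓ₁ T) ℓ
      e₂ = eqFin (ℓ₂ T) ℓ
      x y : ℚ
      x = when (mem r (R₂ T)) (share₂ T)
      y = when (mem r (R₁₂ T)) (share₁₂ T)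
      +-rearrange : ∀ a b c → a + b + c ≡ (a + c) + b
      +-rearrange = solve 3 (λ a b c → a :+ b :+ c := (a :+ c) :+ b) refl

    K-nonneg : ∀ T → 0ℚ ≤ K T
    K-nonneg T = +-mono-≤ (+-mono-≤ (when-nonneg (eqFin (ℓ₂ T) ℓ ∧ mem r (R₂ T)) (share-nonneg T ∣ R₂ T ∣))
                                    (when-nonneg (eqFin (ℓ₁ T) ℓ ∧ mem r (R₁₂ T)) (share-nonneg T ∣ R₁₂ T ∣)))
                          (when-nonneg (eqFin (ℓ₂ T) ℓ ∧ mem r (R₁₂ T)) (share-nonneg T ∣ R₁₂ T ∣))

    lhs≡ : edgeLHS E ℓ r ≡ ∑ (tuples E) (λ T → K T * q E T)
    lhs≡ = begin
      edgeLHS E ℓ r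
        ≡⟨ cong₂ _+_ (cong₂ _+_ (∑-cong Ts (λ T → when-β (eqFin (ℓ₂ T) ℓ ∧ mem r (R₂ T)) T ∣ R₂ T ∣))
                               (∑-cong Ts (λ T → when-β (eqFin (ℓ₁ T) ℓ ∧ mem r (R₁₂ T)) T ∣ R₁₂ T ∣)))
                     (∑-cong Ts (λ T → when-β (eqFin (ℓ₂ T) ℓ ∧ mem r (R₁₂ T)) T ∣ R₁₂ T ∣)) ⟩
      ∑ Ts (λ T → x T * q E T) + ∑ Ts (λ T → y T * q E T) + ∑ Ts (λ T → z T * q E T)
        ≡⟨ cong (_+ ∑ Ts (λ T → z T * q E T)) (∑-+ Ts _ _) ⟨
      ∑ Ts (λ T → x T * q E T + y T * q E T) + ∑ Ts (λ T → z T * q E T)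
        ≡⟨ ∑-+ Ts _ _ ⟨
      ∑ Ts (λ T → x T * q E T + y T * q E T + z T * q E T)
        ≡⟨ ∑-cong Ts (λ T → trans (cong (_+ z T * q E T) (sym (*-distribʳ-+ (q E T) (x T) (y T)))) (sym (*-distribʳ-+ (q E T) (x T + y T) (z T)))) ⟩
      ∑ Ts (λ T → K T * q E T) ∎
      where
      open ≡-Reasoning
      Ts : List (Tuple m n)
      Ts = tuples E
      x y z : Tuple m n → ℚ
      x T = when (eqFin (ℓ₂ T) ℓ ∧ mem r (R₂ T)) (share₂ T)
      y T = when (eqFin (ℓ₁ T) ℓ ∧ mem r (R₁₂ T)) (share₁₂ T)
      z T = when (eqFin (ℓ₂ T) ℓ ∧ mem r (R₁₂ T)) (share₁₂ T)

    gone : ∀ R c → mem r R ≡ false → localCharge K₂ K₁ R c ≡ 0ℚ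
    gone R c r∉R = begin
      localCharge K₂ K₁ R c
        ≡⟨ cong₂ _+_ (cong₂ _+_ (cong (λ b → when b _) (gone-─ ℓ c r∉R)) (cong (λ b → when b _) (gone-∩ c ℓ r∉R)))
                     (cong (λ b → when b _) (gone-∩ ℓ c r∉R)) ⟩
      0ℚ + 0ℚ + 0ℚ
        ≡⟨ trans (+-identityʳ _) (+-identityʳ 0ℚ) ⟩
      0ℚ ∎
      where open ≡-Reasoning

    alive : ∀ L R c → mem ℓ L ≡ true → mem r R ≡ true → localCharge K₂ K₁ R c + survive L R c ≤ 1ℚ
    alive L R c ℓ∈L r∈R = ≤-trans (≤-reflexive (cong (_+ survive L R c) local≡)) (by-center (mem r Nc) refl)
      where
      Nc Nℓ : Subset n
      Nc = Nb E R c
      Nℓ = Nb E R ℓ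
      T₁ T₂ : Tuple m n
      T₁ = stepTuple R c ℓ
      T₂ = stepTuple R ℓ c
      r∈Nℓ : mem r Nℓ ≡ true
      r∈Nℓ = trans (mem-∩ r (E ℓ) R) (cong₂ _∧_ r∈Eℓ r∈R)
      local≡ : localCharge K₂ K₁ R c
             ≡ when (not (mem r Nc)) (share₂ T₁) + when (mem r Nc) (share₁₂ T₁) + when (mem r Nc) (share₁₂ T₂)
      local≡ = cong₂ _+_ (cong₂ _+_
        (cong (λ b → when b (share₂ T₁)) (trans (mem-─ r Nℓ Nc) (cong (_∧ not (mem r Nc)) r∈Nℓ)))
        (cong (λ b → when b (share₁₂ T₁)) (trans (mem-∩ r Nc Nℓ) (trans (cong (mem r Nc ∧_) r∈Nℓ) (BoolP.∧-identityʳ _)))))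
        (cong (λ b → when b (share₁₂ T₂)) (trans (mem-∩ r Nℓ Nc) (cong (_∧ mem r Nc) r∈Nℓ)))
      by-center : ∀ x → mem r Nc ≡ x →
        when (not x) (share₂ T₁) + when x (share₁₂ T₁) + when x (share₁₂ T₂) + survive L R c ≤ 1ℚ
      by-center true r∈Nc = begin
        0ℚ + share₁₂ T₁ + share₁₂ T₂ + survive L R c
          ≡⟨ cong₂ _+_ (cong (_+ share₁₂ T₂) (+-identityˡ (share₁₂ T₁))) (survive≡0 L R c r-taken) ⟩
        share₁₂ T₁ + share₁₂ T₂ + 0ℚ
          ≡⟨ +-identityʳ (share₁₂ T₁ + share₁₂ T₂) ⟩
        share₁₂ T₁ + share₁₂ T₂
          ≡⟨ cong (λ p → share₁₂ T₁ + weight (∣ Nℓ ─ Nc ∣) (∣ p ∣) (∣ Nc ─ Nℓ ∣) * ratio 1 ∣ p ∣) (SubsetP.∩-comm Nℓ Nc) ⟩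
        weight (∣ Nc ─ Nℓ ∣) s (∣ Nℓ ─ Nc ∣) * ratio 1 s + weight (∣ Nℓ ─ Nc ∣) s (∣ Nc ─ Nℓ ∣) * ratio 1 s
          ≤⟨ weight-pair (∣ Nc ─ Nℓ ∣) s (∣ Nℓ ─ Nc ∣) (size≢0 r (Nc ∩ Nℓ) (trans (mem-∩ r Nc Nℓ) (cong₂ _∧_ r∈Nc r∈Nℓ))) ⟩
        1ℚ ∎
        where
        open ≤-Reasoning
        s : ℕ
        s = ∣ Nc ∩ Nℓ ∣
        r-taken : mem ℓ L ∧ (mem r R ∧ not (mem r Nc)) ≡ false
        r-taken = trans (cong (λ b → mem ℓ L ∧ (mem r R ∧ not b)) r∈Nc)
          (trans (cong (mem ℓ L ∧_) (BoolP.∧-zeroʳ (mem r R))) (BoolP.∧-zeroʳ (mem ℓ L)))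
      by-center false r∉Nc = begin
        share₂ T₁ + 0ℚ + 0ℚ + survive L R c
          ≡⟨ cong (_+ survive L R c) (trans (+-identityʳ (share₂ T₁ + 0ℚ)) (+-identityʳ (share₂ T₁))) ⟩
        share₂ T₁ + survive L R c
          ≤⟨ +-mono-≤ (weight-share≤coin (∣ Nc ─ Nℓ ∣) (∣ Nc ∩ Nℓ ∣) (∣ Nℓ ─ Nc ∣))
                      (survive≤1-coin L R c ℓ∈L (distinct r∈Nℓ r∉Nc) r∈R r∉Nc) ⟩
        coin R c ℓ + (1ℚ - coin R c ℓ)
          ≡⟨ p+[1-p] (coin R c ℓ) ⟩
        1ℚ ∎
        where open ≤-Reasoning

  module NonEdge (r∉Eℓ : mem r (E ℓ) ≡ false) where

    K K₂ K₁ : Tuple m n → ℚ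
    K T = when (eqFin (ℓ₁ T) ℓ ∧ mem r (R₂ T)) (share₂ T)
    K₂ T = 0ℚ
    K₁ T = when (mem r (R₂ T)) (share₂ T)

    split : SplitsAs K K₂ K₁
    split T = trans (when-∧ (eqFin (ℓ₁ T) ℓ) _ _)
      (trans (sym (+-identityˡ _)) (cong (_+ when (eqFin (ℓ₁ T) ℓ) (K₁ T)) (sym (when-zero (eqFin (ℓ₂ T) ℓ)))))

    K-nonneg : ∀ T → 0ℚ ≤ K T
    K-nonneg T = when-nonneg (eqFin (ℓ₁ T) ℓ ∧ mem r (R₂ T)) (share-nonneg T ∣ R₂ T ∣)

    lhs≡ : nonEdgeLHS E ℓ r ≡ ∑ (tuples E) (λ T → K T * q E T)
    lhs≡ = ∑-cong (tuples E) (λ T → when-β (eqFin (ℓ₁ T) ℓ ∧ mem r (R₂ T)) T ∣ R₂ T ∣)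

    gone : ∀ R c → mem r R ≡ false → localCharge K₂ K₁ R c ≡ 0ℚ
    gone R c r∉R = trans (+-identityˡ _) (cong (λ b → when b (share₂ (stepTuple R ℓ c))) (gone-─ c ℓ r∉R))

    alive : ∀ L R c → mem ℓ L ≡ true → mem r R ≡ true → localCharge K₂ K₁ R c + survive L R c ≤ 1ℚ
    alive L R c ℓ∈L r∈R = ≤-trans (≤-reflexive (cong (_+ survive L R c) local≡)) (by-center (mem r Nc) refl)
      where
      Nc Nℓ : Subset n
      Nc = Nb E R c
      Nℓ = Nb E R ℓ
      T₂ : Tuple m n
      T₂ = stepTuple R ℓ c
      r∉Nℓ : mem r Nℓ ≡ false
      r∉Nℓ = trans (mem-∩ r (E ℓ) R) (cong (_∧ mem r R) r∉Eℓ)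
      local≡ : localCharge K₂ K₁ R c ≡ when (mem r Nc) (share₂ T₂)
      local≡ = trans (+-identityˡ _) (cong (λ b → when b (share₂ T₂))
        (trans (mem-─ r Nc Nℓ) (trans (cong (λ b → mem r Nc ∧ not b) r∉Nℓ) (BoolP.∧-identityʳ _))))
      by-center : ∀ x → mem r Nc ≡ x → when x (share₂ T₂) + survive L R c ≤ 1ℚ
      by-center true r∈Nc = begin
        share₂ T₂ + survive L R c
          ≡⟨ cong (share₂ T₂ +_) (survive≡0 L R c r-taken) ⟩
        share₂ T₂ + 0ℚ
          ≡⟨ +-identityʳ _ ⟩
        share₂ T₂
          ≤⟨ weight-share≤1 (∣ Nℓ ─ Nc ∣) (∣ Nℓ ∩ Nc ∣) (∣ Nc ─ Nℓ ∣) ⟩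
        1ℚ ∎
        where
        open ≤-Reasoning
        r-taken : mem ℓ L ∧ (mem r R ∧ not (mem r Nc)) ≡ false
        r-taken = trans (cong (λ b → mem ℓ L ∧ (mem r R ∧ not b)) r∈Nc)
          (trans (cong (mem ℓ L ∧_) (BoolP.∧-zeroʳ (mem r R))) (BoolP.∧-zeroʳ (mem ℓ L)))
      by-center false r∉Nc = ≤-trans (≤-reflexive (+-identityˡ _)) (survive≤1 L R c)

lemma2 : (m n : ℕ) (E : BiGraph m n) →
    ((ℓ : Fin m) (r : Fin n) → r ∈ E ℓ → edgeLHS E ℓ r ≤ 1ℚ)
    × ((ℓ : Fin m) (r : Fin n) → r ∉ E ℓ → nonEdgeLHS E ℓ r ≤ 1ℚ)
lemma2 m n E = edge , non-edge
  where
  edge : ∀ ℓ r → r ∈ E ℓ → edgeLHS E ℓ r ≤ 1ℚ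
  edge ℓ r r∈Eℓ = ≤-trans (≤-reflexive lhs≡) (constraint-bound split K-nonneg alive gone)
    where
    open Constraint E ℓ r
    open Edge (VecP.[]=⇒lookup r∈Eℓ)
  non-edge : ∀ ℓ r → r ∉ E ℓ → nonEdgeLHS E ℓ r ≤ 1ℚ
  non-edge ℓ r r∉Eℓ = ≤-trans (≤-reflexive lhs≡) (constraint-bound split K-nonneg alive gone)
    where
    open Constraint E ℓ r
    open NonEdge (BoolP.¬-not (r∉Eℓ ∘ VecP.lookup⇒[]= r (E ℓ)))
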